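{- Let $P$ be a Schröder path and let $(x,z)\in\mathbb{Z}^2$ be a point on $P$ with $z>x+1$ such that the bounce path of $P$ at $(x,z)$ has exactly one bounce point and the bounce decomposition of $P$ at $(x,z)$ is $P=U\mathtt{n}\cdot\mathtt{n}V\mathtt{d}\cdot\mathtt{e}W$. Let $Q=U\mathtt{n}\mathtt{n}V\mathtt{e}\mathtt{d}W$. Then $\mathrm{LLTe}_P(\mathbf{x};q+1)=(q+1)\,\mathrm{LLTe}_Q(\mathbf{x};q+1)$.
   Context: Steps: $\mathtt{n}=(0,1)$, $\mathtt{e}=(1,0)$, $\mathtt{d}=(1,1)$. A Schröder path of size $n$ is a lattice path from $(0,0)$ to $(n,n)$ with steps in $\{\mathtt{n},\mathtt{e},\mathtt{d}\}$ such that every east and every diagonal step is preceded by strictly more north steps than east steps; paths are words in $\{\mathtt{n},\mathtt{d},\mathtt{e}\}^*$. Bounce path of $P$ (size $n$) at a lattice point $(u_1,u_0)$ on $P$: move south from $(u_1,u_0)$ to $(u_1,u_1)$, then west until first reaching a point $(u_2,u_1)$ of $P$; if that point lies between two diagonal steps of $P$, continue south to $(u_2,u_2)$ and west to a point $(u_3,u_2)$ of $P$, and so on, stopping at the first point $(u_{k+1},u_k)$ incident to a north or east step of $P$. The points $(u_i,u_i)$ are the bounce points. The bounce decomposition at $(u_1,u_0)$ is the unique factorisation $P=Us_1\cdot s_2Vs_3\cdot s_4W$ ($s_i$ single steps) where $Us_1$ is the part of $P$ from $(0,0)$ to $(u_{k+1},u_k)$ and $s_4W$ is the part from $(u_1,u_0)$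 to $(n,n)$; dots are only markers. $\Gamma_P$ is the graph on $[n]$ where, for $1\le a<b\le n$, $\{a,b\}$ is a non-strict edge if the unit square $[a-1,a]\times[b-1,b]$ lies in the region between $P$ and the line $y=x$, and a strict edge if $P$ has a diagonal step from $(a-1,b-1)$ to $(a,b)$. An orientation is a set $\theta$ containing, for each edge $\{u,v\}$, exactly one of $u\to v$, $v\to u$; $\mathcal{O}(P)$ is the set of orientations orienting each strict edge $\{u,v\}$, $u<v$, as $u\to v$. An edge $u\to v\in\theta$ is ascending if $u<v$ and $\{u,v\}$ is non-strict; $\mathrm{asc}(\theta)$ counts them. $\mathrm{hrv}_\theta(u)$ is the maximal $v$ reachable from $u$ by a directed path (possibly empty) in $\theta$ using only strict and ascending edges; $\lambda(\theta)$ is the partition formed by the sizes of the classes of vertices with equal $\mathrm{hrv}_\theta$. $\mathrm{LLTe}_P(\mathbf{x};q+1)=\sum_{\theta\in\mathcal{O}(P)}q^{\mathrm{asc}(\theta)}\mathrm{e}_{\lambda(\theta)}(\mathbf{x})$, with $\mathrm{e}_\lambda$ the elementary symmetric functions. -}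

module Defs where

open import Data.Bool using (Bool; true; false; _∧_; _∨_; if_then_else_; T)
open import Data.Nat using (ℕ; zero; suc; _+_; _≡ᵇ_; _<ᵇ_; _⊔_)
open import Data.Integer as ℤ using (ℤ)
open import Data.List using (List; []; _∷_; map; foldr; filter; length; concatMap; upTo; _++_)
open import Data.Product using (_×_; _,_; proj₁; proj₂)
open import Relation.Binary.PropositionalEquality using (_≡_)

data Step : Set where
  N E D : Step

Path : Set
Path = List Step

Point : Set
Point = ℕ × ℕ

move : Point → Step → Point
move (x , y) N = (x , suc y)
move (x , y) E = (suc x , y)
move (x , y) D = (suc x , suc y)

positionsFrom : Point → Path → List Point
positionsFrom p []       = p ∷ []
positionsFrom p (s ∷ ss) = p ∷ positionsFrom (move p s) ss

positions : Path → List Point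
positions = positionsFrom (0 , 0)

endFrom : Point → Path → Point
endFrom p []       = p
endFrom p (s ∷ ss) = endFrom (move p s) ss

endpoint : Path → Point
endpoint = endFrom (0 , 0)

validFrom : ℕ → ℕ → Path → Bool
validFrom a b []       = true
validFrom a b (N ∷ ss) = validFrom (suc a) b ss
validFrom a b (E ∷ ss) = (b <ᵇ a) ∧ validFrom a (suc b) ss
validFrom a b (D ∷ ss) = (b <ᵇ a) ∧ validFrom a b ss

IsSchroder : ℕ → Path → Set
IsSchroder n P = T (validFrom 0 0 P) × (endpoint P ≡ (n , n))

-- largest a with (a , y) a point of P ("move west from (y,y) until first
-- reaching a point of P")
west : Path → ℕ → ℕ
west P y = foldr (λ p m → if proj₂ p ≡ᵇ y then proj₁ p ⊔ m else m) 0 (positions P)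

samePt : Point → Point → Bool
samePt (a , b) (c , e) = (a ≡ᵇ c) ∧ (b ≡ᵇ e)

betweenDiagFrom : Point → Path → Point → Bool
betweenDiagFrom q []             p = false
betweenDiagFrom q (D ∷ D ∷ ss)   p = samePt (move q D) p ∨ betweenDiagFrom (move q D) (D ∷ ss) p
betweenDiagFrom q (s ∷ ss)       p = betweenDiagFrom (move q s) ss p

betweenDiag : Path → Point → Bool
betweenDiag = betweenDiagFrom (0 , 0)

-- bounce fuel P u_i  : given the current u_i, returns
--   ( [u_i , ... , u_k] , (u_{k+1} , u_k) )
bounceAux : ℕ → Path → ℕ → List ℕ × Point
bounceAux fuel P u with betweenDiag P (west P u , u)
bounceAux zero     P u | true  = (u ∷ [] , (west P u , u))
bounceAux (suc f)  P u | true  =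
  let r = bounceAux f P (west P u) in (u ∷ proj₁ r , proj₂ r)
bounceAux fuel     P u | false = (u ∷ [] , (west P u , u))

-- bounce path of P at (x , z): u_1 = x, u_0 = z.
-- bounce points are (u_1,u_1),…,(u_k,u_k); we return [u_1 … u_k].
bouncePoints : Path → ℕ → ℕ → List ℕ
bouncePoints P x z = proj₁ (bounceAux (length P) P x)

bounceEnd : Path → ℕ → ℕ → Point
bounceEnd P x z = proj₂ (bounceAux (length P) P x)

-- rowInfo P b = (c , isDiag) where the unique N or D step of P going from
-- height b-1 to height b starts at (c , b-1).
rowAux : ℕ → ℕ → Path → ℕ → ℕ × Bool
rowAux x y []       b = (0 , false)
rowAux x y (N ∷ ss) b = if suc y ≡ᵇ b then (x , false) else rowAux x (suc y) ss b
rowAux x y (D ∷ ss) b = if suc y ≡ᵇ b then (x , true) else rowAux (suc x) (suc y) ss b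
rowAux x y (E ∷ ss) b = rowAux (suc x) y ss b

rowInfo : Path → ℕ → ℕ × Bool
rowInfo = rowAux 0 0

δ : Bool → ℕ
δ true  = 1
δ false = 0

-- {a,b}, a<b, is non-strict: the unit square [a-1,a]×[b-1,b] lies between P and
-- y = x, i.e. to the right of the step of P crossing row b (and not the square
-- cut by a diagonal step).
nonStrict : Path → ℕ → ℕ → Bool
nonStrict P a b = (a <ᵇ b) ∧ ((proj₁ (rowInfo P b) + δ (proj₂ (rowInfo P b))) <ᵇ a)

-- {a,b}, a<b, is strict: P has a D step from (a-1,b-1) to (a,b)
strict : Path → ℕ → ℕ → Bool
strict P a b = (a <ᵇ b) ∧ proj₂ (rowInfo P b) ∧ (suc (proj₁ (rowInfo P b)) ≡ᵇ a)

vertices : ℕ → List ℕ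
vertices n = map suc (upTo n)

pairs : ℕ → List (ℕ × ℕ)
pairs n = concatMap (λ b → map (λ a → (a , b)) (vertices n)) (vertices n)

nonStrictEdges : ℕ → Path → List (ℕ × ℕ)
nonStrictEdges n P = filter (λ e → T? (nonStrict P (proj₁ e) (proj₂ e))) (pairs n)
  where
  open import Data.Bool.Properties using (T?)

strictArcs : ℕ → Path → List (ℕ × ℕ)
strictArcs n P = filter (λ e → T? (strict P (proj₁ e) (proj₂ e))) (pairs n)
  where
  open import Data.Bool.Properties using (T?)

-- Orientations: an orientation is the list of its arcs (u , v) meaning u → v.
-- O(P): strict edges oriented upwards, each non-strict edge either way.

choices : List (ℕ × ℕ) → List (List (ℕ × ℕ))
choices []             = [] ∷ []
choices ((a , b) ∷ es) =
  concatMap (λ θ → ((a , b) ∷ θ) ∷ ((b , a) ∷ θ) ∷ []) (choices es)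

orientations : ℕ → Path → List (List (ℕ × ℕ))
orientations n P = map (strictArcs n P ++_) (choices (nonStrictEdges n P))

count : {A : Set} → (A → Bool) → List A → ℕ
count p = foldr (λ a k → if p a then suc k else k) 0

asc : Path → List (ℕ × ℕ) → ℕ
asc P θ = count (λ e → (proj₁ e <ᵇ proj₂ e) ∧ nonStrict P (proj₁ e) (proj₂ e)) θ

usable : Path → ℕ × ℕ → Bool
usable P e = strict P (proj₁ e) (proj₂ e)
           ∨ ((proj₁ e <ᵇ proj₂ e) ∧ nonStrict P (proj₁ e) (proj₂ e))

hrvAux : ℕ → Path → List (ℕ × ℕ) → ℕ → ℕ
hrvAux zero    P θ u = u
hrvAux (suc f) P θ u =
  foldr (λ e m → if (proj₁ e ≡ᵇ u) ∧ usable P e then hrvAux f P θ (proj₂ e) ⊔ m else m) u θ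

-- all usable arcs go upward, so paths have length < n and fuel n suffices
hrv : ℕ → Path → List (ℕ × ℕ) → ℕ → ℕ
hrv n P θ u = hrvAux n P θ u

-- Symmetric functions, evaluated at finitely many integer variables

elem : ℕ → List ℤ → ℤ
elem zero    xs       = ℤ.1ℤ
elem (suc k) []       = ℤ.0ℤ
elem (suc k) (x ∷ xs) = x ℤ.* elem k xs ℤ.+ elem (suc k) xs

prodℤ : List ℤ → ℤ
prodℤ = foldr ℤ._*_ ℤ.1ℤ

sumℤ : List ℤ → ℤ
sumℤ = foldr ℤ._+_ ℤ.0ℤ

-- e_{λ(θ)}(x): product over the classes {u : hrv u = h}, h ∈ [n], of e_{size};
-- empty classes contribute e_0 = 1.
eLambda : ℕ → Path → List (ℕ × ℕ) → List ℤ → ℤ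
eLambda n P θ xs =
  prodℤ (map (λ h → elem (count (λ u → hrv n P θ u ≡ᵇ h) (vertices n)) xs) (vertices n))

-- LLTe_P(x ; q+1) = Σ_{θ ∈ O(P)} q^asc(θ) e_{λ(θ)}(x), evaluated at x = xs, q = q
LLTe : ℕ → Path → List ℤ → ℤ → ℤ
LLTe n P xs q = sumℤ (map (λ θ → (q ℤ.^ asc P θ) ℤ.* eLambda n P θ xs) (orientations n P))

{-# OPTIONS --safe #-}
module Submission where

-- Let u = h+1 and v = h+2 be the rows of the two north steps and z the row of the diagonal
-- step. Γ_P and Γ_Q share all edges except that Γ_P has the strict arc u → z and the
-- non-strict edge {v, z} where Γ_Q has the strict arc v → z, and away from u, v, z the
-- transposition (u v) maps the edges of Γ_P onto those of Γ_Q. Fix the orientation R of the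
-- shared non-strict edges other than {u, v}. Since hrv is the unique solution of
-- hrv w = max (w , hrv t over the usable arcs w → t), an arc a → b with hrv b ≤ hrv a can be
-- added or removed without changing hrv. Hence P with u → v → z has the λ of Q with u → v;
-- of the two mixed orientations of P one has that λ as well and the other the λ of P with
-- v → u and z → v; and the latter, relabelled by (u v), is the λ of Q with v → u and R
-- relabelled. With a = q ^ asc(R) the four P-terms add up to
-- q²a λ₁ + qa (λ₂ + λ₃) + a λ₄ = (q + 1) (qa λ₁ + a λ₄), and summing over R gives the theorem.

open import Defs
open import Algebra.Bundles using (CommutativeMonoid)
open import Data.Bool using (Bool; true; false; T; if_then_else_; _∧_; _∨_)
open import Data.Bool.Properties using (T?; T-∧; T-≡; ⇔→≡; ∧-zeroʳ; ∨-zeroʳ)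
open import Data.Empty using (⊥; ⊥-elim)
open import Data.Integer using (ℤ; _+_; _*_; 1ℤ)
import Data.Integer as ℤ
import Data.Integer.Properties as ℤ
open import Data.Integer.Solver using (module +-*-Solver)
open import Algebra.Properties.CommutativeSemigroup ℤ.+-commutativeSemigroup using (interchange)
open import Data.List using (List; []; _∷_; _++_; map; concatMap; foldr; filter; length)
open import Data.List.Properties using (map-++; map-∘; map-cong)
open import Data.List.Membership.Propositional using (_∈_; find)
open import Data.List.Membership.Propositional.Properties
  using (∈-concatMap⁻; ∈-map⁻; ∈-map⁺; ∈-applyUpTo⁻; ∈-applyUpTo⁺; ∈-concat⁻′; ∈-concat⁺′; ∈-filter⁻; ∈-filter⁺;
         ∈-++⁻; ∈-++⁺ˡ; ∈-++⁺ʳ)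
open import Data.List.Membership.Propositional.Properties.WithK using (unique∧set⇒bag)
open import Data.List.Relation.Unary.Any using (here; there)
open import Data.List.Relation.Unary.All using (All; []; _∷_)
import Data.List.Relation.Unary.All as All
import Data.List.Relation.Unary.All.Properties as All
open import Data.List.Relation.Unary.AllPairs using ([]; _∷_)
import Data.List.Relation.Unary.AllPairs as AllPairs
import Data.List.Relation.Unary.AllPairs.Properties as AllPairs
open import Data.List.Relation.Unary.Unique.Propositional using (Unique)
import Data.List.Relation.Unary.Unique.Propositional.Properties as Unique
open import Data.List.Relation.Binary.BagAndSetEquality using (∼bag⇒↭)
open import Data.List.Relation.Binary.Disjoint.Propositional using (Disjoint)
open import Data.List.Relation.Binary.Permutation.Propositional
  using (_↭_; ↭⇒↭ₛ; ↭-refl; ↭-prep; ↭-swap; ↭-trans; ↭-sym)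
import Data.List.Relation.Binary.Permutation.Propositional as ↭
import Data.List.Relation.Binary.Permutation.Propositional.Properties as ↭
open import Data.List.Relation.Binary.Permutation.Propositional.Properties using (∈-resp-↭; shift; ++⁺ˡ; ++⁺ʳ)
open import Data.List.Relation.Binary.Permutation.Setoid.Properties using (foldr-commMonoid)
open import Data.Nat using (ℕ; zero; suc; _≡ᵇ_; _<ᵇ_; _⊔_; _≤_; _<_; _∸_; z≤n; s≤s; _≤?_; _≟_)
import Data.Nat as ℕ
open import Data.Nat.Properties
open import Data.Product using (_×_; _,_; proj₁; proj₂; ∃-syntax)
open import Data.Product.Properties using (≡-dec)
open import Data.Sum as Sum using (_⊎_; inj₁; inj₂)
open import Data.Unit using (⊤; tt)
open import Function using (_⇔_; mk⇔; Equivalence; id; _∘_)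
open import Level using (0ℓ)
open import Relation.Nullary using (¬_; yes; no; Dec)
open import Relation.Nullary.Decidable using (_×-dec_; _⊎-dec_; ¬?)
open import Relation.Unary using (Decidable)
open import Relation.Binary.Core using (Rel)
open import Relation.Binary.PropositionalEquality

open Equivalence using (to; from)

≡ᵇ-refl : ∀ x → (x ≡ᵇ x) ≡ true
≡ᵇ-refl zero    = refl
≡ᵇ-refl (suc x) = ≡ᵇ-refl x

≢⇒≡ᵇ≡false : ∀ {x y} → x ≢ y → (x ≡ᵇ y) ≡ false
≢⇒≡ᵇ≡false {x} {y} x≢y with x ≡ᵇ y in eq
... | false = refl
... | true  = ⊥-elim (x≢y (≡ᵇ⇒≡ x y (from T-≡ eq)))

≡ᵇ≡false⇒≢ : ∀ {x y} → (x ≡ᵇ y) ≡ false → x ≢ y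
≡ᵇ≡false⇒≢ {x} {y} eq x≡y = subst T eq (≡⇒≡ᵇ x y x≡y)

<⇒<ᵇ≡true : ∀ {a b} → a < b → (a <ᵇ b) ≡ true
<⇒<ᵇ≡true {a} {b} a<b with a <ᵇ b in eq
... | true  = refl
... | false = ⊥-elim (subst T eq (<⇒<ᵇ a<b))

≥⇒<ᵇ≡false : ∀ {a b} → b ≤ a → (a <ᵇ b) ≡ false
≥⇒<ᵇ≡false {a} {b} b≤a with a <ᵇ b in eq
... | false = refl
... | true  = ⊥-elim (<⇒≱ (<ᵇ⇒< a b (from T-≡ eq)) b≤a)

T-cong : ∀ {a b} → (T a ⇔ T b) → a ≡ b
T-cong iff = ⇔→≡ {z = true} (mk⇔ (to T-≡ ∘ to iff ∘ from T-≡) (to T-≡ ∘ from iff ∘ from T-≡))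

≡ᵇ-cong : ∀ {x y x′ y′} → (x ≡ y ⇔ x′ ≡ y′) → (x ≡ᵇ y) ≡ (x′ ≡ᵇ y′)
≡ᵇ-cong {x} {y} {x′} {y′} iff = T-cong (mk⇔ (≡⇒≡ᵇ x′ y′ ∘ to iff ∘ ≡ᵇ⇒≡ x y) (≡⇒≡ᵇ x y ∘ from iff ∘ ≡ᵇ⇒≡ x′ y′))

<ᵇ-cong : ∀ {a b c d} → (a < b ⇔ c < d) → (a <ᵇ b) ≡ (c <ᵇ d)
<ᵇ-cong {a} {b} {c} {d} iff = T-cong (mk⇔ (<⇒<ᵇ ∘ to iff ∘ <ᵇ⇒< a b) (<⇒<ᵇ ∘ from iff ∘ <ᵇ⇒< c d))

-- Highest reachable vertices of an abstract graph

record IsSuccMax (G : Rel ℕ 0ℓ) (K : ℕ → ℕ) (w m : ℕ) : Set where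
  constructor mkSuccMax
  field
    lower    : w ≤ m
    upper    : ∀ t → G w t → K t ≤ m
    attained : m ≡ w ⊎ ∃[ t ] G w t × m ≡ K t
open IsSuccMax public

IsHrv : Rel ℕ 0ℓ → (ℕ → ℕ) → Set
IsHrv G K = ∀ w → IsSuccMax G K w (K w)

Upward : ℕ → Rel ℕ 0ℓ → Set
Upward n G = ∀ a b → G a b → a < b × b ≤ n

SameOut : Rel ℕ 0ℓ → Rel ℕ 0ℓ → ℕ → Set
SameOut G G′ w = ∀ t → G w t ⇔ G′ w t

IsSuccMax-≤ : ∀ {G K w m m′} → IsSuccMax G K w m → IsSuccMax G K w m′ → m ≤ m′
IsSuccMax-≤ M M′ with attained M
... | inj₁ refl            = lower M′
... | inj₂ (t , e , refl)  = upper M′ t e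

IsSuccMax-unique : ∀ {G K w m m′} → IsSuccMax G K w m → IsSuccMax G K w m′ → m ≡ m′
IsSuccMax-unique M M′ = ≤-antisym (IsSuccMax-≤ M M′) (IsSuccMax-≤ M′ M)

IsSuccMax-cong : ∀ {G G′ K K′ w m} → SameOut G G′ w → (∀ t → G w t → K t ≡ K′ t) →
                 IsSuccMax G K w m → IsSuccMax G′ K′ w m
IsSuccMax-cong {G} {G′} {K} {K′} {w} {m} same K≡K′ M = mkSuccMax (lower M) upper′ attained′
  where
  upper′ : ∀ t → G′ w t → K′ t ≤ m
  upper′ t e = subst (_≤ m) (K≡K′ t (from (same t) e)) (upper M t (from (same t) e))
  attained′ : m ≡ w ⊎ ∃[ t ] G′ w t × m ≡ K′ t
  attained′ with attained M
  ... | inj₁ m≡w           = inj₁ m≡w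
  ... | inj₂ (t , e , m≡)  = inj₂ (t , to (same t) e , trans m≡ (K≡K′ t e))

IsSuccMax-none : ∀ {G K w m} → (∀ t → ¬ G w t) → IsSuccMax G K w m → m ≡ w
IsSuccMax-none none M with attained M
... | inj₁ m≡w         = m≡w
... | inj₂ (t , e , _) = ⊥-elim (none t e)

IsSuccMax-add : ∀ {G G′ K w m} y → (∀ t → G′ w t → G w t ⊎ t ≡ y) → (∀ t → G w t → G′ w t) →
                G′ w y → IsSuccMax G K w m → IsSuccMax G′ K w (m ⊔ K y)
IsSuccMax-add {G} {G′} {K} {w} {m} y split keep new M =
  mkSuccMax (≤-trans (lower M) (m≤m⊔n m (K y))) upper′ attained′
  where
  upper′ : ∀ t → G′ w t → K t ≤ m ⊔ K y
  upper′ t e with split t e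
  ... | inj₁ e′   = ≤-trans (upper M t e′) (m≤m⊔n m (K y))
  ... | inj₂ refl = m≤n⊔m m (K t)
  attained′ : m ⊔ K y ≡ w ⊎ ∃[ t ] G′ w t × m ⊔ K y ≡ K t
  attained′ with ⊔-sel m (K y) | attained M
  ... | inj₂ ≡Ky | _                     = inj₂ (y , new , ≡Ky)
  ... | inj₁ ≡m  | inj₁ m≡w              = inj₁ (trans ≡m m≡w)
  ... | inj₁ ≡m  | inj₂ (t , e , m≡Kt)   = inj₂ (t , keep t e , trans ≡m m≡Kt)

Upward-ind : ∀ {n G} → Upward n G → (S : ℕ → Set) →
             (∀ w → (∀ t → G w t → S t) → S w) → ∀ w → S w
Upward-ind {n} {G} up S step w = go (suc (n ∸ w)) w ≤-refl
  where
  go : ∀ k w → n ∸ w < k → S w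
  go (suc k) w lt = step w λ t e →
    go k t (<-≤-trans (∸-monoʳ-< (proj₁ (up w t e)) (proj₂ (up w t e))) (≤-pred lt))

IsHrv-agree : ∀ {n G G′ K K′} (S : ℕ → Set) → Upward n G → IsHrv G K → IsHrv G′ K′ →
              (∀ w t → S w → G w t → S t) → (∀ w → S w → K w ≡ K′ w ⊎ SameOut G G′ w) →
              ∀ w → S w → K w ≡ K′ w
IsHrv-agree {G = G} {G′} {K} {K′} S up H H′ closed split = Upward-ind up (λ w → S w → K w ≡ K′ w) step
  where
  step : ∀ w → (∀ t → G w t → S t → K t ≡ K′ t) → S w → K w ≡ K′ w
  step w IH sw with split w sw
  ... | inj₁ eq   = eq
  ... | inj₂ same = IsSuccMax-unique
                      (IsSuccMax-cong same (λ t e → IH t e (closed w t sw e)) (H w)) (H′ w)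

IsHrv-unique : ∀ {n G K K′} → Upward n G → IsHrv G K → IsHrv G K′ → ∀ w → K w ≡ K′ w
IsHrv-unique up H H′ w =
  IsHrv-agree (λ _ → ⊤) up H H′ _ (λ _ _ → inj₂ (λ _ → mk⇔ id id)) w tt

record HrvOf (n : ℕ) (G : Rel ℕ 0ℓ) (K : ℕ → ℕ) : Set where
  field
    upward : Upward n G
    isHrv  : IsHrv G K
open HrvOf public

HrvOf-unique : ∀ {n G K K′} → HrvOf n G K → IsHrv G K′ → ∀ w → K w ≡ K′ w
HrvOf-unique H H′ = IsHrv-unique (upward H) (isHrv H) H′

IsHrv-addArc : ∀ {G G′ K} a b → (∀ x y → G′ x y → G x y ⊎ (x ≡ a × y ≡ b)) →
               (∀ x y → G x y → G′ x y) → K b ≤ K a → IsHrv G K → IsHrv G′ K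
IsHrv-addArc {G} {G′} {K} a b split keep Kb≤Ka H w = mkSuccMax (lower (H w)) upper′ attained′
  where
  upper′ : ∀ t → G′ w t → K t ≤ K w
  upper′ t e with split w t e
  ... | inj₁ e′            = upper (H w) t e′
  ... | inj₂ (refl , refl) = Kb≤Ka
  attained′ : K w ≡ w ⊎ ∃[ t ] G′ w t × K w ≡ K t
  attained′ with attained (H w)
  ... | inj₁ eq           = inj₁ eq
  ... | inj₂ (t , e , eq) = inj₂ (t , keep w t e , eq)

IsHrv-notValue : ∀ {n G K} c → Upward n G → IsHrv G K → K c ≢ c → ∀ t → K t ≢ c
IsHrv-notValue {G = G} {K} c up H Kc≢c = Upward-ind up (λ t → K t ≢ c) step
  where
  step : ∀ t → (∀ t′ → G t t′ → K t′ ≢ c) → K t ≢ c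
  step t IH Kt≡c with attained (H t)
  ... | inj₁ Kt≡t           = Kc≢c (subst (λ x → K x ≡ c) (trans (sym Kt≡t) Kt≡c) Kt≡c)
  ... | inj₂ (t′ , e , eq)  = IH t′ e (trans (sym eq) Kt≡c)

transpose : ℕ → ℕ → ℕ
transpose u x = if x ≡ᵇ u then suc u else if x ≡ᵇ suc u then u else x

module _ (u : ℕ) where

  data TransposeView (x : ℕ) : Set where
    isFst  : x ≡ u → TransposeView x
    isSnd  : x ≡ suc u → TransposeView x
    isRest : x ≢ u → x ≢ suc u → TransposeView x

  transposeView : ∀ x → TransposeView x
  transposeView x with x ≟ u | x ≟ suc u
  ... | yes x≡u | _         = isFst x≡u
  ... | no _    | yes x≡u+1 = isSnd x≡u+1
  ... | no x≢u  | no x≢u+1  = isRest x≢u x≢u+1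

  transpose-fst : transpose u u ≡ suc u
  transpose-fst rewrite ≡ᵇ-refl u = refl

  transpose-snd : transpose u (suc u) ≡ u
  transpose-snd rewrite ≢⇒≡ᵇ≡false {suc u} {u} 1+n≢n | ≡ᵇ-refl u = refl

  transpose-rest : ∀ {x} → x ≢ u → x ≢ suc u → transpose u x ≡ x
  transpose-rest x≢u x≢u+1 rewrite ≢⇒≡ᵇ≡false x≢u | ≢⇒≡ᵇ≡false x≢u+1 = refl

  transpose-involutive : ∀ x → transpose u (transpose u x) ≡ x
  transpose-involutive x with transposeView x
  ... | isFst refl             rewrite transpose-fst = transpose-snd
  ... | isSnd refl             rewrite transpose-snd = transpose-fst
  ... | isRest x≢u x≢u+1       rewrite transpose-rest x≢u x≢u+1 = transpose-rest x≢u x≢u+1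

  transpose-injective : ∀ {x y} → transpose u x ≡ transpose u y → x ≡ y
  transpose-injective {x} {y} eq =
    trans (sym (transpose-involutive x)) (trans (cong (transpose u) eq) (transpose-involutive y))

  transpose-mono-≤ : ∀ {x y} → x ≤ y → ¬ (x ≡ u × y ≡ suc u) → transpose u x ≤ transpose u y
  transpose-mono-≤ {x} {y} x≤y not-uv with transposeView x | transposeView y
  ... | isFst refl     | isFst refl     = ≤-refl
  ... | isFst refl     | isSnd refl     = ⊥-elim (not-uv (refl , refl))
  ... | isFst refl     | isRest y≢u y≢v rewrite transpose-fst | transpose-rest y≢u y≢v =
    ≤∧≢⇒< x≤y (≢-sym y≢u)
  ... | isSnd refl     | isFst refl     = ⊥-elim (<⇒≱ (n<1+n u) x≤y)
  ... | isSnd refl     | isSnd refl     = ≤-refl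
  ... | isSnd refl     | isRest y≢u y≢v rewrite transpose-snd | transpose-rest y≢u y≢v =
    ≤-trans (n≤1+n u) x≤y
  ... | isRest x≢u x≢v | isFst refl     rewrite transpose-fst | transpose-rest x≢u x≢v =
    ≤-trans x≤y (n≤1+n u)
  ... | isRest x≢u x≢v | isSnd refl     rewrite transpose-snd | transpose-rest x≢u x≢v =
    ≤-pred (≤∧≢⇒< x≤y x≢v)
  ... | isRest x≢u x≢v | isRest y≢u y≢v rewrite transpose-rest x≢u x≢v | transpose-rest y≢u y≢v = x≤y

  transpose-mono-< : ∀ {x y} → x < y → ¬ (x ≡ u × y ≡ suc u) → transpose u x < transpose u y
  transpose-mono-< x<y not-uv =
    ≤∧≢⇒< (transpose-mono-≤ (<⇒≤ x<y) not-uv) (λ eq → <⇒≢ x<y (transpose-injective eq))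

  transpose-<-⇔ : ∀ {x y} → ¬ (x ≡ u × y ≡ suc u) → ¬ (x ≡ suc u × y ≡ u) →
                  transpose u x < transpose u y ⇔ x < y
  transpose-<-⇔ {x} {y} not-uv not-vu = mk⇔
    (λ lt → subst₂ _<_ (transpose-involutive x) (transpose-involutive y)
              (transpose-mono-< lt λ (x≡u , y≡v) → not-vu ( transpose-injective (trans x≡u (sym transpose-snd))
                                                          , transpose-injective (trans y≡v (sym transpose-fst)))))
    (λ lt → transpose-mono-< lt not-uv)

  -- transpose u is monotone except on the pair (u , u+1); the hypotheses on K keep every
  -- comparison of maxima away from that pair.
  IsHrv-transpose : ∀ {G G′ K} → (∀ t → K t ≢ u) → K u ≢ suc u →
                    (∀ x y → G′ x y ⇔ G (transpose u x) (transpose u y)) → IsHrv G K →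
                    IsHrv G′ (λ w → transpose u (K (transpose u w)))
  IsHrv-transpose {G} {G′} {K} K≢u Ku≢v rel H w = mkSuccMax lower′ upper′ attained′
    where
    s = transpose u
    M = H (s w)
    lower′ : w ≤ s (K (s w))
    lower′ = subst (_≤ s (K (s w))) (transpose-involutive w)
               (transpose-mono-≤ (lower M) λ (sw≡u , Ksw≡v) → Ku≢v (subst (λ x → K x ≡ suc u) sw≡u Ksw≡v))
    upper′ : ∀ t → G′ w t → s (K (s t)) ≤ s (K (s w))
    upper′ t e = transpose-mono-≤ (upper M (s t) (to (rel w t) e)) (λ (Kst≡u , _) → K≢u (s t) Kst≡u)
    attained′ : s (K (s w)) ≡ w ⊎ ∃[ t ] G′ w t × s (K (s w)) ≡ s (K (s t))
    attained′ with attained M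
    ... | inj₁ eq           = inj₁ (trans (cong s eq) (transpose-involutive w))
    ... | inj₂ (t , e , eq) = inj₂ (s t , from (rel w (s t)) (subst (G (s w)) (sym (transpose-involutive t)) e)
                                   , cong s (trans eq (cong K (sym (transpose-involutive t)))))

  Upward-transpose : ∀ {n G G′} → Upward n G → suc u ≤ n → ¬ G u (suc u) →
                     (∀ x y → G′ x y → G (transpose u x) (transpose u y)) → Upward n G′
  Upward-transpose {n} {G} up v≤n no-uv rel x y e = x<y , y≤n
    where
    s = transpose u
    sx<sy = proj₁ (up (s x) (s y) (rel x y e))
    x<y : x < y
    x<y = ≤∧≢⇒< (subst₂ _≤_ (transpose-involutive x) (transpose-involutive y)
                   (transpose-mono-≤ (<⇒≤ sx<sy) λ (sx≡u , sy≡v) → no-uv (subst₂ G sx≡u sy≡v (rel x y e))))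
                 (λ x≡y → <⇒≢ sx<sy (cong s x≡y))
    y≤n : y ≤ n
    y≤n with transposeView y
    ... | isFst refl       = ≤-trans (n≤1+n u) v≤n
    ... | isSnd refl       = v≤n
    ... | isRest y≢u y≢v   = subst (_≤ n) (transpose-rest y≢u y≢v) (proj₂ (up (s x) (s y) (rel x y e)))

-- Edges of Γ_P

Arc : Set
Arc = ℕ × ℕ

flipArc : Arc → Arc
flipArc (a , b) = (b , a)

mapArc : (ℕ → ℕ) → Arc → Arc
mapArc f (a , b) = (f a , f b)

_≟Arc_ : (e e′ : Arc) → Dec (e ≡ e′)
_≟Arc_ = ≡-dec _≟_ _≟_

split-at : ∀ {q : Arc → Set} {x} e → q x → x ≡ e ⊎ (q x × x ≢ e)
split-at {x = x} e qx with x ≟Arc e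
... | yes x≡e = inj₁ x≡e
... | no  x≢e = inj₂ (qx , x≢e)

-- nonStrict X a b and strict X a b are definitionally
-- edgeRow nonStrictCond (rowInfo X b) a b and edgeRow strictCond (rowInfo X b) a b.
edgeRow : (ℕ × Bool → ℕ → Bool) → ℕ × Bool → ℕ → ℕ → Bool
edgeRow cond r a b = (a <ᵇ b) ∧ cond r a

nonStrictCond strictCond : ℕ × Bool → ℕ → Bool
nonStrictCond (c , d) a = c ℕ.+ δ d <ᵇ a
strictCond    (c , d) a = d ∧ (suc c ≡ᵇ a)

nonStrict-true : ∀ X a b {c d} → rowInfo X b ≡ (c , d) → a < b → c ℕ.+ δ d < a → nonStrict X a b ≡ true
nonStrict-true X a b eq a<b t<a rewrite eq | <⇒<ᵇ≡true a<b | <⇒<ᵇ≡true t<a = refl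

nonStrict-false : ∀ X a b {c d} → rowInfo X b ≡ (c , d) → a ≤ c ℕ.+ δ d → nonStrict X a b ≡ false
nonStrict-false X a b eq a≤t rewrite eq | ≥⇒<ᵇ≡false a≤t = ∧-zeroʳ _

strict-true : ∀ X b {c} → rowInfo X b ≡ (c , true) → suc c < b → strict X (suc c) b ≡ true
strict-true X b {c} eq c<b rewrite eq | <⇒<ᵇ≡true c<b | ≡ᵇ-refl c = refl

strict-false : ∀ X a b {c d} → rowInfo X b ≡ (c , d) → suc c ≢ a → strict X a b ≡ false
strict-false X a b {d = d} eq c+1≢a rewrite eq | ≢⇒≡ᵇ≡false c+1≢a | ∧-zeroʳ d = ∧-zeroʳ _

strict-north : ∀ X a b {c} → rowInfo X b ≡ (c , false) → strict X a b ≡ false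
strict-north X a b eq rewrite eq = ∧-zeroʳ _

strict⇒¬nonStrict : ∀ X a b → strict X a b ≡ true → nonStrict X a b ≡ false
strict⇒¬nonStrict X a b s with rowInfo X b
... | (c , false) with () ← trans (sym s) (∧-zeroʳ (a <ᵇ b))
... | (c , true) with suc c ≟ a
...   | yes refl rewrite ≥⇒<ᵇ≡false {c ℕ.+ 1} {suc c} (≤-reflexive (+-comm 1 c)) = ∧-zeroʳ (a <ᵇ b)
...   | no c+1≢a rewrite ≢⇒≡ᵇ≡false c+1≢a with () ← trans (sym s) (∧-zeroʳ (a <ᵇ b))

-- asc X θ is definitionally count (isAscending X) θ.
isAscending : Path → Arc → Bool
isAscending X e = (proj₁ e <ᵇ proj₂ e) ∧ nonStrict X (proj₁ e) (proj₂ e)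

usable-strict : ∀ X c d → strict X c d ≡ true → usable X (c , d) ≡ true
usable-strict X c d s rewrite s = refl

usable-ascending : ∀ X c d → isAscending X (c , d) ≡ true → usable X (c , d) ≡ true
usable-ascending X c d a rewrite a = ∨-zeroʳ (strict X c d)

usable-down : ∀ X {c d} → d ≤ c → usable X (c , d) ≡ false
usable-down X d≤c rewrite ≥⇒<ᵇ≡false d≤c = refl

usable⇒< : ∀ X c d → usable X (c , d) ≡ true → c < d
usable⇒< X c d us with c <ᵇ d in c<ᵇd
... | true  = <ᵇ⇒< c d (from T-≡ c<ᵇd)
... | false with () ← us

nonStrict⇒< : ∀ X c d → nonStrict X c d ≡ true → c < d
nonStrict⇒< X c d ns with c <ᵇ d in c<ᵇd
... | true  = <ᵇ⇒< c d (from T-≡ c<ᵇd)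
... | false with () ← ns

ascending-true : ∀ X {c d} → c < d → nonStrict X c d ≡ true → isAscending X (c , d) ≡ true
ascending-true X c<d ns = cong₂ _∧_ (<⇒<ᵇ≡true c<d) ns

ascending-false : ∀ X c d → nonStrict X c d ≡ false → isAscending X (c , d) ≡ false
ascending-false X c d ns = trans (cong ((c <ᵇ d) ∧_) ns) (∧-zeroʳ (c <ᵇ d))

ascending-down : ∀ X {c d} → d ≤ c → isAscending X (c , d) ≡ false
ascending-down X d≤c rewrite ≥⇒<ᵇ≡false d≤c = refl

UsableArc : Path → List Arc → Rel ℕ 0ℓ
UsableArc P θ a b = (a , b) ∈ θ × T (usable P (a , b))

-- hrvAux (suc f) P θ w unfolds to hrvStep P (hrvAux f P θ) w θ.
hrvStep : Path → (ℕ → ℕ) → ℕ → List Arc → ℕ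
hrvStep P K w = foldr (λ e m → if (proj₁ e ≡ᵇ w) ∧ usable P e then K (proj₂ e) ⊔ m else m) w

hrvStep-IsSuccMax : ∀ P K w θ → IsSuccMax (UsableArc P θ) K w (hrvStep P K w θ)
hrvStep-IsSuccMax P K w []            = mkSuccMax ≤-refl (λ _ ()) (inj₁ refl)
hrvStep-IsSuccMax P K w ((a , b) ∷ θ) with (a ≡ᵇ w) ∧ usable P (a , b) in eq
... | true  = subst (IsSuccMax _ K w) (⊔-comm _ (K b))
                (IsSuccMax-add b split (λ _ (m , us) → there m , us) new IH)
  where
  IH = hrvStep-IsSuccMax P K w θ
  a≡w×usable = to T-∧ (from T-≡ eq)
  new : UsableArc P ((a , b) ∷ θ) w b
  new with refl ← ≡ᵇ⇒≡ a w (proj₁ a≡w×usable) = here refl , proj₂ a≡w×usable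
  split : ∀ t → UsableArc P ((a , b) ∷ θ) w t → UsableArc P θ w t ⊎ t ≡ b
  split t (here refl , _) = inj₂ refl
  split t (there m , us)  = inj₁ (m , us)
... | false = IsSuccMax-cong (λ t → mk⇔ (λ (m , us) → there m , us) (old t)) (λ _ _ → refl)
                (hrvStep-IsSuccMax P K w θ)
  where
  old : ∀ t → UsableArc P ((a , b) ∷ θ) w t → UsableArc P θ w t
  old t (here refl , us) = ⊥-elim (subst T eq (from T-∧ (≡⇒≡ᵇ w w refl , us)))
  old t (there m , us)   = m , us

hrvAux-stable : ∀ {n P θ} → Upward n (UsableArc P θ) →
                ∀ w f g → n ∸ w ≤ f → n ∸ w ≤ g → hrvAux f P θ w ≡ hrvAux g P θ w
hrvAux-stable {n} {P} {θ} up = Upward-ind up _ step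
  where
  G = UsableArc P θ
  closer : ∀ {w t f} → G w t → n ∸ w ≤ suc f → n ∸ t ≤ f
  closer {w} {t} e le = ≤-pred (≤-trans (∸-monoʳ-< (proj₁ (up w t e)) (proj₂ (up w t e))) le)
  top : ∀ {w} → n ∸ w ≤ 0 → ∀ t → ¬ G w t
  top {w} le t e = <⇒≱ (∸-monoʳ-< (proj₁ (up w t e)) (proj₂ (up w t e))) (≤-trans le z≤n)
  step : ∀ w → (∀ t → G w t → ∀ f g → n ∸ t ≤ f → n ∸ t ≤ g → hrvAux f P θ t ≡ hrvAux g P θ t) →
         ∀ f g → n ∸ w ≤ f → n ∸ w ≤ g → hrvAux f P θ w ≡ hrvAux g P θ w
  step w IH zero    zero    _  _  = refl
  step w IH zero    (suc g) lf _  = sym (IsSuccMax-none (top lf) (hrvStep-IsSuccMax P _ w θ))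
  step w IH (suc f) zero    _  lg = IsSuccMax-none (top lg) (hrvStep-IsSuccMax P _ w θ)
  step w IH (suc f) (suc g) lf lg = IsSuccMax-unique
    (IsSuccMax-cong (λ _ → mk⇔ id id) (λ t e → IH t e f g (closer e lf) (closer e lg))
      (hrvStep-IsSuccMax P _ w θ))
    (hrvStep-IsSuccMax P _ w θ)

hrv-IsHrv : ∀ {n P θ} → Upward n (UsableArc P θ) → IsHrv (UsableArc P θ) (hrv n P θ)
hrv-IsHrv {zero}  {P} {θ} up w =
  mkSuccMax ≤-refl (λ t e → ⊥-elim (n≮0 (<-≤-trans (proj₁ (up w t e)) (proj₂ (up w t e))))) (inj₁ refl)
hrv-IsHrv {suc n} {P} {θ} up w =
  IsSuccMax-cong (λ _ → mk⇔ id id)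
    (λ t e → hrvAux-stable up t n (suc n) (below t (proj₁ (up w t e))) (m∸n≤m (suc n) t))
    (hrvStep-IsSuccMax P (hrvAux n P θ) w θ)
  where
  below : ∀ t → w < t → suc n ∸ t ≤ n
  below (suc t) _ = m∸n≤m n t

hrv-cong : ∀ f {P P′ θ θ′} → (∀ a b → UsableArc P θ a b ⇔ UsableArc P′ θ′ a b) →
           ∀ w → hrvAux f P θ w ≡ hrvAux f P′ θ′ w
hrv-cong zero    same w = refl
hrv-cong (suc f) {P} {P′} {θ} {θ′} same w = IsSuccMax-unique
  (IsSuccMax-cong (same w) (λ t _ → hrv-cong f same t) (hrvStep-IsSuccMax P _ w θ))
  (hrvStep-IsSuccMax P′ _ w θ′)

upward-usable : ∀ {n X θ} → (∀ {a b} → (a , b) ∈ θ → b ≤ n) → Upward n (UsableArc X θ)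
upward-usable {X = X} bound a b (ab∈ , us) = usable⇒< X a b (to T-≡ us) , bound ab∈

-- Sums over orientations

sumℤ-++ : ∀ xs ys → sumℤ (xs ++ ys) ≡ sumℤ xs + sumℤ ys
sumℤ-++ []       ys = sym (ℤ.+-identityˡ (sumℤ ys))
sumℤ-++ (x ∷ xs) ys = trans (cong (x +_) (sumℤ-++ xs ys)) (sym (ℤ.+-assoc x (sumℤ xs) (sumℤ ys)))

sumℤ-concatMap : ∀ {A B : Set} (g : B → ℤ) (h : A → List B) xs →
                 sumℤ (map g (concatMap h xs)) ≡ sumℤ (map (λ x → sumℤ (map g (h x))) xs)
sumℤ-concatMap g h []       = refl
sumℤ-concatMap g h (x ∷ xs) = begin
  sumℤ (map g (h x ++ concatMap h xs))             ≡⟨ cong sumℤ (map-++ g (h x) (concatMap h xs)) ⟩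
  sumℤ (map g (h x) ++ map g (concatMap h xs))     ≡⟨ sumℤ-++ (map g (h x)) _ ⟩
  sumℤ (map g (h x)) + sumℤ (map g (concatMap h xs)) ≡⟨ cong (sumℤ (map g (h x)) +_) (sumℤ-concatMap g h xs) ⟩
  sumℤ (map g (h x)) + sumℤ (map (λ x → sumℤ (map g (h x))) xs) ∎
  where open ≡-Reasoning

sumℤ-map-cong : ∀ {A : Set} {f g : A → ℤ} xs → (∀ x → x ∈ xs → f x ≡ g x) →
                sumℤ (map f xs) ≡ sumℤ (map g xs)
sumℤ-map-cong []       f≡g = refl
sumℤ-map-cong (x ∷ xs) f≡g = cong₂ _+_ (f≡g x (here refl)) (sumℤ-map-cong xs (λ y m → f≡g y (there m)))

sumℤ-map-+ : ∀ {A : Set} (f g : A → ℤ) xs →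
             sumℤ (map (λ x → f x + g x) xs) ≡ sumℤ (map f xs) + sumℤ (map g xs)
sumℤ-map-+ f g []       = refl
sumℤ-map-+ f g (x ∷ xs) =
  trans (cong (f x + g x +_) (sumℤ-map-+ f g xs)) (interchange (f x) (g x) (sumℤ (map f xs)) (sumℤ (map g xs)))

sumℤ-map-* : ∀ {A : Set} c (f : A → ℤ) xs → sumℤ (map (λ x → c * f x) xs) ≡ c * sumℤ (map f xs)
sumℤ-map-* c f []       = sym (ℤ.*-zeroʳ c)
sumℤ-map-* c f (x ∷ xs) = trans (cong (c * f x +_) (sumℤ-map-* c f xs)) (sym (ℤ.*-distribˡ-+ c (f x) _))

sumChoices : List Arc → (List Arc → ℤ) → ℤ
sumChoices es g = sumℤ (map g (choices es))

sumChoices-cons : ∀ a b es g →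
  sumChoices ((a , b) ∷ es) g ≡ sumChoices es (λ θ → g ((a , b) ∷ θ) + g ((b , a) ∷ θ))
sumChoices-cons a b es g =
  trans (sumℤ-concatMap g _ (choices es))
        (sumℤ-map-cong (choices es) (λ θ _ → cong (g ((a , b) ∷ θ) +_) (ℤ.+-identityʳ (g ((b , a) ∷ θ)))))

sumChoices-cong : ∀ es {g h} → (∀ θ → g θ ≡ h θ) → sumChoices es g ≡ sumChoices es h
sumChoices-cong es g≡h = sumℤ-map-cong (choices es) (λ θ _ → g≡h θ)

Respects↭ : (List Arc → ℤ) → Set
Respects↭ g = ∀ {θ θ′} → θ ↭ θ′ → g θ ≡ g θ′

sumChoices-↭ : ∀ {es es′} → es ↭ es′ → ∀ g → Respects↭ g → sumChoices es g ≡ sumChoices es′ g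
sumChoices-↭ ↭.refl g resp = refl
sumChoices-↭ {(a , b) ∷ es} {_ ∷ es′} (↭.prep _ p) g resp = begin
  sumChoices ((a , b) ∷ es) g                                ≡⟨ sumChoices-cons a b es g ⟩
  sumChoices es (λ θ → g ((a , b) ∷ θ) + g ((b , a) ∷ θ))
    ≡⟨ sumChoices-↭ p _ (λ p′ → cong₂ _+_ (resp (↭-prep _ p′)) (resp (↭-prep _ p′))) ⟩
  sumChoices es′ (λ θ → g ((a , b) ∷ θ) + g ((b , a) ∷ θ))   ≡⟨ sumChoices-cons a b es′ g ⟨
  sumChoices ((a , b) ∷ es′) g                               ∎
  where open ≡-Reasoning
sumChoices-↭ {(a , b) ∷ (c , d) ∷ es} {_ ∷ _ ∷ es′} (↭.swap _ _ p) g resp = begin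
  sumChoices ((a , b) ∷ (c , d) ∷ es) g
    ≡⟨ trans (sumChoices-cons a b ((c , d) ∷ es) g) (sumChoices-cons c d es _) ⟩
  sumChoices es (λ θ → (g (ab ∷ cd ∷ θ) + g (ba ∷ cd ∷ θ)) + (g (ab ∷ dc ∷ θ) + g (ba ∷ dc ∷ θ)))
    ≡⟨ sumChoices-↭ p _ (λ p′ → cong₂ _+_ (cong₂ _+_ (resp (↭-prep _ (↭-prep _ p′))) (resp (↭-prep _ (↭-prep _ p′))))
                                         (cong₂ _+_ (resp (↭-prep _ (↭-prep _ p′))) (resp (↭-prep _ (↭-prep _ p′))))) ⟩
  sumChoices es′ (λ θ → (g (ab ∷ cd ∷ θ) + g (ba ∷ cd ∷ θ)) + (g (ab ∷ dc ∷ θ) + g (ba ∷ dc ∷ θ)))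
    ≡⟨ sumChoices-cong es′ (λ θ →
         trans (interchange (g (ab ∷ cd ∷ θ)) (g (ba ∷ cd ∷ θ)) (g (ab ∷ dc ∷ θ)) (g (ba ∷ dc ∷ θ)))
         (cong₂ _+_ (cong₂ _+_ (resp (↭-swap _ _ ↭-refl)) (resp (↭-swap _ _ ↭-refl)))
                    (cong₂ _+_ (resp (↭-swap _ _ ↭-refl)) (resp (↭-swap _ _ ↭-refl))))) ⟩
  sumChoices es′ (λ θ → (g (cd ∷ ab ∷ θ) + g (dc ∷ ab ∷ θ)) + (g (cd ∷ ba ∷ θ) + g (dc ∷ ba ∷ θ)))
    ≡⟨ trans (sumChoices-cons c d ((a , b) ∷ es′) g) (sumChoices-cons a b es′ _) ⟨
  sumChoices ((c , d) ∷ (a , b) ∷ es′) g ∎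
  where
  open ≡-Reasoning
  ab = (a , b)
  ba = (b , a)
  cd = (c , d)
  dc = (d , c)
sumChoices-↭ (↭.trans p p′) g resp = trans (sumChoices-↭ p g resp) (sumChoices-↭ p′ g resp)

choices-map : ∀ f es → choices (map (mapArc f) es) ≡ map (map (mapArc f)) (choices es)
choices-map f []             = refl
choices-map f ((a , b) ∷ es) rewrite choices-map f es = go (choices es)
  where
  go : ∀ θs → concatMap (λ θ → ((f a , f b) ∷ θ) ∷ ((f b , f a) ∷ θ) ∷ []) (map (map (mapArc f)) θs)
            ≡ map (map (mapArc f)) (concatMap (λ θ → ((a , b) ∷ θ) ∷ ((b , a) ∷ θ) ∷ []) θs)
  go []       = refl
  go (θ ∷ θs) = cong (λ rest → _ ∷ _ ∷ rest) (go θs)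

sumChoices-map : ∀ f es g → sumChoices (map (mapArc f) es) g ≡ sumChoices es (λ θ → g (map (mapArc f) θ))
sumChoices-map f es g rewrite choices-map f es = sym (cong sumℤ (map-∘ (choices es)))

∈-choices : ∀ {es θ e} → θ ∈ choices es → e ∈ θ → e ∈ es ⊎ flipArc e ∈ es
∈-choices {[]}           (here refl) ()
∈-choices {(a , b) ∷ es} θ∈ e∈ with find (∈-concatMap⁻ _ {xs = choices es} θ∈) | e∈
... | _ , _   , here refl         | here refl = inj₁ (here refl)
... | _ , _   , there (here refl) | here refl = inj₂ (here refl)
... | _ , θ′∈ , here refl         | there e∈′ = Sum.map there there (∈-choices θ′∈ e∈′)
... | _ , θ′∈ , there (here refl) | there e∈′ = Sum.map there there (∈-choices θ′∈ e∈′)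

-- Rearranging the four orientations of {u, v} and {v, z}.
regroup : ∀ q a x y w t → y + w ≡ x + t →
          (q * (q * a) * x + q * a * y) + (q * a * w + a * t) ≡ (q + 1ℤ) * (q * a * x + a * t)
regroup q a x y w t y+w≡x+t = begin
  (q * (q * a) * x + q * a * y) + (q * a * w + a * t)  ≡⟨ solve 6 (λ q a x y w t →
      (q :* (q :* a) :* x :+ q :* a :* y) :+ (q :* a :* w :+ a :* t)
        := q :* (q :* a) :* x :+ (q :* a) :* (y :+ w) :+ a :* t)
      refl q a x y w t ⟩
  q * (q * a) * x + q * a * (y + w) + a * t            ≡⟨ cong (λ k → q * (q * a) * x + q * a * k + a * t) y+w≡x+t ⟩
  q * (q * a) * x + q * a * (x + t) + a * t            ≡⟨ solve 4 (λ q a x t →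
      q :* (q :* a) :* x :+ (q :* a) :* (x :+ t) :+ a :* t := (q :+ con 1ℤ) :* (q :* a :* x :+ a :* t)) refl q a x t ⟩
  (q + 1ℤ) * (q * a * x + a * t)                       ∎
  where
  open ≡-Reasoning
  open +-*-Solver

count-↭ : ∀ {A : Set} (p : A → Bool) {xs ys} → xs ↭ ys → count p xs ≡ count p ys
count-↭ p ↭.refl                                    = refl
count-↭ p (↭.prep x r)   rewrite count-↭ p r        = refl
count-↭ p (↭.swap x y r) rewrite count-↭ p r with p x | p y
... | true  | true  = refl
... | true  | false = refl
... | false | true  = refl
... | false | false = refl
count-↭ p (↭.trans r r′) = trans (count-↭ p r) (count-↭ p r′)

count-cong : ∀ {A : Set} {p p′ : A → Bool} xs → (∀ x → x ∈ xs → p x ≡ p′ x) → count p xs ≡ count p′ xs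
count-cong []       p≡p′ = refl
count-cong (x ∷ xs) p≡p′ rewrite p≡p′ x (here refl) | count-cong xs (λ y m → p≡p′ y (there m)) = refl

count-map : ∀ {A B : Set} (p : B → Bool) (f : A → B) xs → count p (map f xs) ≡ count (p ∘ f) xs
count-map p f []                               = refl
count-map p f (x ∷ xs) rewrite count-map p f xs = refl

count-++ : ∀ {A : Set} (p : A → Bool) xs ys → count p (xs ++ ys) ≡ count p xs ℕ.+ count p ys
count-++ p []       ys = refl
count-++ p (x ∷ xs) ys with p x
... | true  = cong suc (count-++ p xs ys)
... | false = count-++ p xs ys

count-none : ∀ {A : Set} (p : A → Bool) xs → (∀ x → x ∈ xs → p x ≡ false) → count p xs ≡ 0
count-none p []       none = refl
count-none p (x ∷ xs) none rewrite none x (here refl) = count-none p xs (λ y m → none y (there m))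

count-yes : ∀ {A : Set} (p : A → Bool) x xs → p x ≡ true → count p (x ∷ xs) ≡ suc (count p xs)
count-yes p x xs px rewrite px = refl

count-no : ∀ {A : Set} (p : A → Bool) x xs → p x ≡ false → count p (x ∷ xs) ≡ count p xs
count-no p x xs px rewrite px = refl

prodℤ-↭ : ∀ {xs ys} → xs ↭ ys → prodℤ xs ≡ prodℤ ys
prodℤ-↭ p = foldr-commMonoid ℤ*1.setoid ℤ*1.isCommutativeMonoid (↭⇒↭ₛ p)
  where module ℤ*1 = CommutativeMonoid ℤ.*-1-commutativeMonoid

↭-unique-sameElements : ∀ {A : Set} {xs ys : List A} → Unique xs → Unique ys →
                         (∀ {e} → e ∈ xs ⇔ e ∈ ys) → xs ↭ ys
↭-unique-sameElements ux uy same = ∼bag⇒↭ (unique∧set⇒bag ux uy same)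

filter-↭-cons : ∀ {A : Set} {p q : A → Set} (p? : Decidable p) (q? : Decidable q) {xs e} →
                Unique xs → e ∈ xs → ¬ q e → (∀ {x} → p x ⇔ (x ≡ e ⊎ q x)) →
                filter p? xs ↭ e ∷ filter q? xs
filter-↭-cons {q = q} p? q? {xs} {e} uxs e∈ ¬qe p⇔ =
  ↭-unique-sameElements (Unique.filter⁺ p? uxs)
    (All.tabulate (λ x∈ e≡x → ¬qe (subst q (sym e≡x) (proj₂ (∈-filter⁻ q? {xs = xs} x∈)))) ∷ Unique.filter⁺ q? uxs)
    (mk⇔ into back)
  where
  into : ∀ {x} → x ∈ filter p? xs → x ∈ e ∷ filter q? xs
  into x∈ with ∈-filter⁻ p? {xs = xs} x∈
  ... | x∈xs , px with to p⇔ px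
  ...   | inj₁ x≡e = here x≡e
  ...   | inj₂ qx  = there (∈-filter⁺ q? x∈xs qx)
  back : ∀ {x} → x ∈ e ∷ filter q? xs → x ∈ filter p? xs
  back (here refl) = ∈-filter⁺ p? e∈ (from p⇔ (inj₁ refl))
  back (there x∈)  = let x∈xs , qx = ∈-filter⁻ q? {xs = xs} x∈ in ∈-filter⁺ p? x∈xs (from p⇔ (inj₂ qx))

IsVertex : ℕ → ℕ → Set
IsVertex n a = 1 ≤ a × a ≤ n

∈-vertices⁻ : ∀ {n a} → a ∈ vertices n → IsVertex n a
∈-vertices⁻ a∈ with ∈-map⁻ suc a∈
... | i , i∈ , refl with ∈-applyUpTo⁻ id i∈
...   | j , j<n , refl = s≤s z≤n , j<n

∈-vertices⁺ : ∀ {n a} → IsVertex n a → a ∈ vertices n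
∈-vertices⁺ {a = suc a} (s≤s z≤n , a<n) = ∈-map⁺ suc (∈-applyUpTo⁺ id a<n)

vertices-unique : ∀ n → Unique (vertices n)
vertices-unique n = AllPairs.map⁺ (AllPairs.applyUpTo⁺₁ id n (λ i<j _ eq → <⇒≢ i<j (suc-injective eq)))

pairsRow : ℕ → ℕ → List (ℕ × ℕ)
pairsRow n b = map (λ a → (a , b)) (vertices n)

∈-pairs⁻ : ∀ {n a b} → (a , b) ∈ pairs n → IsVertex n a × IsVertex n b
∈-pairs⁻ {n} ab∈ with ∈-concat⁻′ (map (pairsRow n) (vertices n)) ab∈
... | row , ab∈row , row∈ with ∈-map⁻ (pairsRow n) row∈
...   | b , b∈ , refl with ∈-map⁻ (λ a → (a , b)) ab∈row
...     | a , a∈ , refl = ∈-vertices⁻ a∈ , ∈-vertices⁻ b∈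

∈-pairs⁺ : ∀ {n a b} → IsVertex n a → IsVertex n b → (a , b) ∈ pairs n
∈-pairs⁺ {n} {a} {b} va vb =
  ∈-concat⁺′ (∈-map⁺ (λ a → (a , b)) (∈-vertices⁺ va)) (∈-map⁺ (pairsRow n) (∈-vertices⁺ vb))

pairs-unique : ∀ n → Unique (pairs n)
pairs-unique n = Unique.concat⁺ (All.map⁺ (rowsUnique (vertices n)))
                   (AllPairs.map⁺ (AllPairs.map rowsDisjoint (vertices-unique n)))
  where
  rowsUnique : ∀ bs → All (Unique ∘ pairsRow n) bs
  rowsUnique []       = []
  rowsUnique (b ∷ bs) = AllPairs.map⁺ (AllPairs.map (λ a≢a′ eq → a≢a′ (cong proj₁ eq)) (vertices-unique n))
                        ∷ rowsUnique bs
  rowsDisjoint : ∀ {b b′} → b ≢ b′ → Disjoint (pairsRow n b) (pairsRow n b′)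
  rowsDisjoint {b} {b′} b≢b′ (e∈ , e∈′) with ∈-map⁻ (λ a → (a , b)) e∈ | ∈-map⁻ (λ a → (a , b′)) e∈′
  ... | _ , _ , refl | _ , _ , eq = b≢b′ (cong proj₂ eq)

module _ (u : ℕ) where

  transpose-IsVertex : ∀ {n w} → 1 ≤ u → suc u ≤ n → IsVertex n w → IsVertex n (transpose u w)
  transpose-IsVertex {w = w} 1≤u v≤n vw with transposeView u w
  ... | isFst refl       rewrite transpose-fst u = s≤s z≤n , v≤n
  ... | isSnd refl       rewrite transpose-snd u = 1≤u , ≤-trans (n≤1+n u) v≤n
  ... | isRest w≢u w≢v   rewrite transpose-rest u w≢u w≢v = vw

  transpose-vertices : ∀ {n} → 1 ≤ u → suc u ≤ n → map (transpose u) (vertices n) ↭ vertices n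
  transpose-vertices {n} 1≤u v≤n =
    ↭-unique-sameElements (Unique.map⁺ (transpose-injective u) (vertices-unique n)) (vertices-unique n)
      (mk⇔ image⊆ ⊆image)
    where
    image⊆ : ∀ {w} → w ∈ map (transpose u) (vertices n) → w ∈ vertices n
    image⊆ w∈ with ∈-map⁻ (transpose u) w∈
    ... | _ , w∈′ , refl = ∈-vertices⁺ (transpose-IsVertex 1≤u v≤n (∈-vertices⁻ w∈′))
    ⊆image : ∀ {w} → w ∈ vertices n → w ∈ map (transpose u) (vertices n)
    ⊆image {w} w∈ = subst (_∈ map (transpose u) (vertices n)) (transpose-involutive u w)
                      (∈-map⁺ (transpose u) (∈-vertices⁺ (transpose-IsVertex 1≤u v≤n (∈-vertices⁻ w∈))))

-- eLambda n X θ xs is definitionally eLambdaOf n (hrv n X θ) xs.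
eLambdaOf : ℕ → (ℕ → ℕ) → List ℤ → ℤ
eLambdaOf n K xs = prodℤ (map (λ h → elem (count (λ w → K w ≡ᵇ h) (vertices n)) xs) (vertices n))

eLambdaOf-cong : ∀ n {K K′} xs → (∀ w → K w ≡ K′ w) → eLambdaOf n K xs ≡ eLambdaOf n K′ xs
eLambdaOf-cong n xs K≡K′ = cong prodℤ (map-cong (λ h → cong (λ k → elem k xs)
  (count-cong (vertices n) (λ w _ → cong (_≡ᵇ h) (K≡K′ w)))) (vertices n))

-- e_λ depends only on the multiset of class sizes, so relabelling the vertices does not change it.
eLambdaOf-conjugate : ∀ n (σ : ℕ → ℕ) K xs → (∀ x → σ (σ x) ≡ x) → map σ (vertices n) ↭ vertices n →
                      eLambdaOf n (σ ∘ K ∘ σ) xs ≡ eLambdaOf n K xs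
eLambdaOf-conjugate n σ K xs σσ σvs = begin
  prodℤ (map (λ h → elem (count (λ w → σ (K (σ w)) ≡ᵇ h) vs) xs) vs)
    ≡⟨ cong prodℤ (map-cong (λ h → cong (λ k → elem k xs) (classSize h)) vs) ⟩
  prodℤ (map (F ∘ σ) vs)                  ≡⟨ cong prodℤ (map-∘ vs) ⟩
  prodℤ (map F (map σ vs))                ≡⟨ prodℤ-↭ (↭.map⁺ F σvs) ⟩
  prodℤ (map F vs)                        ∎
  where
  open ≡-Reasoning
  vs = vertices n
  F : ℕ → ℤ
  F h = elem (count (λ w → K w ≡ᵇ h) vs) xs
  classSize : ∀ h → count (λ w → σ (K (σ w)) ≡ᵇ h) vs ≡ count (λ w → K w ≡ᵇ σ h) vs
  classSize h = begin
    count (λ w → σ (K (σ w)) ≡ᵇ h) vs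
      ≡⟨ count-cong vs (λ w _ → ≡ᵇ-cong (mk⇔ (λ eq → trans (sym (σσ _)) (cong σ eq))
                                             (λ eq → trans (cong σ eq) (σσ h)))) ⟩
    count (λ w → K (σ w) ≡ᵇ σ h) vs         ≡⟨ count-map (λ w → K w ≡ᵇ σ h) σ vs ⟨
    count (λ w → K w ≡ᵇ σ h) (map σ vs)     ≡⟨ count-↭ _ σvs ⟩
    count (λ w → K w ≡ᵇ σ h) vs             ∎

endFrom-++ : ∀ p L R → endFrom p (L ++ R) ≡ endFrom (endFrom p L) R
endFrom-++ p []      R = refl
endFrom-++ p (s ∷ L) R = endFrom-++ (move p s) L R

endFrom-through : ∀ {p q} L R → endFrom p L ≡ q → endFrom p (L ++ R) ≡ endFrom q R
endFrom-through {p} L R eq = trans (endFrom-++ p L R) (cong (λ r → endFrom r R) eq)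

_≼_ : Point → Point → Set
(c , y) ≼ (c′ , y′) = c ≤ c′ × y ≤ y′

move-≼ : ∀ p s → p ≼ move p s
move-≼ (c , y) N = ≤-refl , n≤1+n y
move-≼ (c , y) E = n≤1+n c , ≤-refl
move-≼ (c , y) D = n≤1+n c , n≤1+n y

endFrom-≼ : ∀ p L → p ≼ endFrom p L
endFrom-≼ p       []      = ≤-refl , ≤-refl
endFrom-≼ (c , y) (s ∷ L) with move-≼ (c , y) s | endFrom-≼ (move (c , y) s) L
... | c≤ , y≤ | c≤′ , y≤′ = ≤-trans c≤ c≤′ , ≤-trans y≤ y≤′

rowFrom : Point → Path → ℕ → ℕ × Bool
rowFrom (c , y) = rowAux c y

height : Point → Path → ℕ
height p L = proj₂ (endFrom p L)

rowAux-below : ∀ c y R b → b ≤ y → rowAux c y R b ≡ (0 , false)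
rowAux-below c y []      b b≤y = refl
rowAux-below c y (N ∷ R) b b≤y rewrite ≢⇒≡ᵇ≡false (>⇒≢ (s≤s b≤y)) = rowAux-below c (suc y) R b (m≤n⇒m≤1+n b≤y)
rowAux-below c y (D ∷ R) b b≤y rewrite ≢⇒≡ᵇ≡false (>⇒≢ (s≤s b≤y)) = rowAux-below (suc c) (suc y) R b (m≤n⇒m≤1+n b≤y)
rowAux-below c y (E ∷ R) b b≤y = rowAux-below (suc c) y R b b≤y

rowAux-++ʳ : ∀ c y L R b → height (c , y) L < b → rowAux c y (L ++ R) b ≡ rowFrom (endFrom (c , y) L) R b
rowAux-++ʳ c y []      R b lt = refl
rowAux-++ʳ c y (N ∷ L) R b lt
  rewrite ≢⇒≡ᵇ≡false (<⇒≢ (≤-<-trans (proj₂ (endFrom-≼ (c , suc y) L)) lt)) = rowAux-++ʳ c (suc y) L R b lt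
rowAux-++ʳ c y (D ∷ L) R b lt
  rewrite ≢⇒≡ᵇ≡false (<⇒≢ (≤-<-trans (proj₂ (endFrom-≼ (suc c , suc y) L)) lt)) = rowAux-++ʳ (suc c) (suc y) L R b lt
rowAux-++ʳ c y (E ∷ L) R b lt = rowAux-++ʳ (suc c) y L R b lt

rowAux-++ˡ : ∀ c y L R b → b ≤ height (c , y) L → rowAux c y (L ++ R) b ≡ rowAux c y L b
rowAux-++ˡ c y []      R b le = rowAux-below c y R b le
rowAux-++ˡ c y (N ∷ L) R b le with suc y ≡ᵇ b
... | true  = refl
... | false = rowAux-++ˡ c (suc y) L R b le
rowAux-++ˡ c y (D ∷ L) R b le with suc y ≡ᵇ b
... | true  = refl
... | false = rowAux-++ˡ (suc c) (suc y) L R b le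
rowAux-++ˡ c y (E ∷ L) R b le = rowAux-++ˡ (suc c) y L R b le

rowAux-bounds : ∀ c y L b → y < b → b ≤ height (c , y) L →
  let (col , diag) = rowAux c y L b in c ≤ col × col ℕ.+ δ diag ≤ proj₁ (endFrom (c , y) L)
rowAux-bounds c y []      b y<b b≤y = ⊥-elim (<⇒≱ y<b b≤y)
rowAux-bounds c y (N ∷ L) b y<b le with suc y ≡ᵇ b in eq
... | true  = ≤-refl , ≤-trans (≤-reflexive (+-identityʳ c)) (proj₁ (endFrom-≼ (c , suc y) L))
... | false = rowAux-bounds c (suc y) L b (≤∧≢⇒< y<b (≡ᵇ≡false⇒≢ eq)) le
rowAux-bounds c y (D ∷ L) b y<b le with suc y ≡ᵇ b in eq
... | true  = ≤-refl , ≤-trans (≤-reflexive (+-comm c 1)) (proj₁ (endFrom-≼ (suc c , suc y) L))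
... | false with rowAux-bounds (suc c) (suc y) L b (≤∧≢⇒< y<b (≡ᵇ≡false⇒≢ eq)) le
...   | c<col , bound = ≤-trans (n≤1+n c) c<col , bound
rowAux-bounds c y (E ∷ L) b y<b le with rowAux-bounds (suc c) y L b y<b le
... | c<col , bound = ≤-trans (n≤1+n c) c<col , bound

-- The local move d e ↦ e d

-- In the paper's notation P = U n · n V d · e W and Q = U n n V e d W: the two north steps
-- are the rows u = h+1 and v = h+2, both starting in column col, the diagonal step of P
-- reaches row z, and every other row above v treats u and v alike.
record Config (P Q : Path) (n h z : ℕ) : Set where
  field
    col        : ℕ
    col≤h      : col ≤ h
    v<z        : suc (suc h) < z
    z≤size     : z ≤ n
    row-≢z     : ∀ b → b ≢ z → rowInfo P b ≡ rowInfo Q b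
    rowP-z     : rowInfo P z ≡ (h , true)
    rowQ-z     : rowInfo Q z ≡ (suc h , true)
    rowP-u     : rowInfo P (suc h) ≡ (col , false)
    rowP-v     : rowInfo P (suc (suc h)) ≡ (col , false)
    rowP-above : ∀ b → suc (suc h) < b → b ≤ n → b ≢ z →
                 let (c , d) = rowInfo P b in c ℕ.+ δ d ≤ h ⊎ suc (suc h) ≤ c

module _ (U V W : Path) {n a h y : ℕ}
         (endU : endpoint U ≡ (a , h))
         (endV : endFrom (a , suc (suc h)) V ≡ (h , y))
         (endW : endFrom (suc (suc h) , suc y) W ≡ (n , n))
         (v<z  : suc (suc h) < suc y) where

  private
    withTail : Path → Path
    withTail T = U ++ N ∷ N ∷ V ++ T

    row-≤h : ∀ T b → b ≤ h → rowInfo (withTail T) b ≡ rowInfo U b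
    row-≤h T b b≤h = rowAux-++ˡ 0 0 U _ b (subst (λ p → b ≤ proj₂ p) (sym endU) b≤h)

    row->h : ∀ T b → h < b → rowInfo (withTail T) b ≡ rowAux a h (N ∷ N ∷ V ++ T) b
    row->h T b h<b = trans (rowAux-++ʳ 0 0 U _ b (subst (λ p → proj₂ p < b) (sym endU) h<b))
                           (cong (λ p → rowFrom p (N ∷ N ∷ V ++ T) b) endU)

    row-u : ∀ T → rowInfo (withTail T) (suc h) ≡ (a , false)
    row-u T rewrite row->h T (suc h) ≤-refl | ≡ᵇ-refl h = refl

    row-v : ∀ T → rowInfo (withTail T) (suc (suc h)) ≡ (a , false)
    row-v T rewrite row->h T (suc (suc h)) (n≤1+n (suc h)) | ≢⇒≡ᵇ≡false {suc h} {suc (suc h)} (≢-sym 1+n≢n)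
                  | ≡ᵇ-refl h = refl

    row->v : ∀ T b → suc (suc h) < b → rowInfo (withTail T) b ≡ rowAux a (suc (suc h)) (V ++ T) b
    row->v T b v<b rewrite row->h T b (<-trans (n<1+n h) (<-trans (n<1+n (suc h)) v<b))
      | ≢⇒≡ᵇ≡false (<⇒≢ (<-trans (n<1+n (suc h)) v<b)) | ≢⇒≡ᵇ≡false (<⇒≢ v<b) = refl

    row-mid : ∀ T b → suc (suc h) < b → b ≤ y → rowInfo (withTail T) b ≡ rowAux a (suc (suc h)) V b
    row-mid T b v<b b≤y = trans (row->v T b v<b) (rowAux-++ˡ a _ V T b (subst (λ p → b ≤ proj₂ p) (sym endV) b≤y))

    row->y : ∀ T b → y < b → rowInfo (withTail T) b ≡ rowAux h y T b
    row->y T b y<b = trans (row->v T b (≤-<-trans (≤-pred v<z) y<b))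
      (trans (rowAux-++ʳ a _ V T b (subst (λ p → proj₂ p < b) (sym endV) y<b)) (cong (λ p → rowFrom p T b) endV))

    P Q : Path
    P = withTail (D ∷ E ∷ W)
    Q = withTail (E ∷ D ∷ W)

    rowP->z : ∀ b → suc y < b → rowInfo P b ≡ rowAux (suc (suc h)) (suc y) W b
    rowP->z b z<b rewrite row->y (D ∷ E ∷ W) b (<-trans (n<1+n y) z<b) | ≢⇒≡ᵇ≡false (<⇒≢ z<b) = refl

    rowQ->z : ∀ b → suc y < b → rowInfo Q b ≡ rowAux (suc (suc h)) (suc y) W b
    rowQ->z b z<b rewrite row->y (E ∷ D ∷ W) b (<-trans (n<1+n y) z<b) | ≢⇒≡ᵇ≡false (<⇒≢ z<b) = refl

    rowP-z : rowInfo P (suc y) ≡ (h , true)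
    rowP-z rewrite row->y (D ∷ E ∷ W) (suc y) (n<1+n y) | ≡ᵇ-refl y = refl

    rowQ-z : rowInfo Q (suc y) ≡ (suc h , true)
    rowQ-z rewrite row->y (E ∷ D ∷ W) (suc y) (n<1+n y) | ≡ᵇ-refl y = refl

    row-≢z : ∀ b → b ≢ suc y → rowInfo P b ≡ rowInfo Q b
    row-≢z b b≢z with b ≤? h | b ≟ suc h | b ≟ suc (suc h) | b ≤? y
    ... | yes b≤h | _        | _        | _ = trans (row-≤h _ b b≤h) (sym (row-≤h _ b b≤h))
    ... | no _    | yes refl | _        | _ = trans (row-u _) (sym (row-u _))
    ... | no _    | no _     | yes refl | _ = trans (row-v _) (sym (row-v _))
    ... | no b≰h  | no b≢u   | no b≢v   | yes b≤y =
      trans (row-mid _ b v<b b≤y) (sym (row-mid _ b v<b b≤y))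
      where v<b = ≤∧≢⇒< (≤∧≢⇒< (≰⇒> b≰h) (≢-sym b≢u)) (≢-sym b≢v)
    ... | no _    | no _     | no _     | no b≰y =
      trans (rowP->z b z<b) (sym (rowQ->z b z<b))
      where z<b = ≤∧≢⇒< (≰⇒> b≰y) (≢-sym b≢z)

    z≤size : suc y ≤ n
    z≤size = subst (λ p → suc y ≤ proj₂ p) endW (proj₂ (endFrom-≼ (suc (suc h) , suc y) W))

    a≤h : a ≤ h
    a≤h = subst (λ p → a ≤ proj₁ p) endV (proj₁ (endFrom-≼ (a , suc (suc h)) V))

    rowP-above : ∀ b → suc (suc h) < b → b ≤ n → b ≢ suc y →
                 let (c , d) = rowInfo P b in c ℕ.+ δ d ≤ h ⊎ suc (suc h) ≤ c
    rowP-above b v<b b≤n b≢z with b ≤? y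
    ... | yes b≤y rewrite row-mid (D ∷ E ∷ W) b v<b b≤y =
      inj₁ (subst (λ p → let (c , d) = rowAux a _ V b in c ℕ.+ δ d ≤ proj₁ p) endV
              (proj₂ (rowAux-bounds a _ V b v<b (subst (λ p → b ≤ proj₂ p) (sym endV) b≤y))))
    ... | no b≰y = above (≤∧≢⇒< (≰⇒> b≰y) (≢-sym b≢z))
      where
      above : suc y < b → let (c , d) = rowInfo P b in c ℕ.+ δ d ≤ h ⊎ suc (suc h) ≤ c
      above z<b rewrite rowP->z b z<b =
        inj₂ (proj₁ (rowAux-bounds (suc (suc h)) (suc y) W b z<b (subst (λ p → b ≤ proj₂ p) (sym endW) b≤n)))

  factorisation-Config : Config P Q n h (suc y)
  factorisation-Config = record
    { col = a ; col≤h = a≤h ; v<z = v<z ; z≤size = z≤size ; row-≢z = row-≢z ; rowP-z = rowP-z ; rowQ-z = rowQ-z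
    ; rowP-u = row-u _ ; rowP-v = row-v _ ; rowP-above = rowP-above }

module Move {P Q : Path} {n h z : ℕ} (cfg : Config P Q n h z) where

  open Config cfg

  u v : ℕ
  u = suc h
  v = suc (suc h)

  uz uv vz vu zv : Arc
  uz = (u , z)
  uv = (u , v)
  vz = (v , z)
  vu = (v , u)
  zv = (z , v)

  u<v : u < v
  u<v = n<1+n u

  u<z : u < z
  u<z = <-trans u<v v<z

  v≤n : v ≤ n
  v≤n = <⇒≤ (<-≤-trans v<z z≤size)

  col<u : col < u
  col<u = s≤s col≤h

  rowQ-u : rowInfo Q u ≡ (col , false)
  rowQ-u = trans (sym (row-≢z u (<⇒≢ u<z))) rowP-u

  rowQ-v : rowInfo Q v ≡ (col , false)
  rowQ-v = trans (sym (row-≢z v (<⇒≢ v<z))) rowP-v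

  nonStrict-≢z : ∀ {c d} → d ≢ z → nonStrict P c d ≡ nonStrict Q c d
  nonStrict-≢z {c} {d} d≢z = cong (λ r → edgeRow nonStrictCond r c d) (row-≢z d d≢z)

  strict-≢z : ∀ {c d} → d ≢ z → strict P c d ≡ strict Q c d
  strict-≢z {c} {d} d≢z = cong (λ r → edgeRow strictCond r c d) (row-≢z d d≢z)

  nonStrict-z : ∀ {c} → c ≢ v → nonStrict P c z ≡ nonStrict Q c z
  nonStrict-z {c} c≢v rewrite rowP-z | rowQ-z =
    cong ((c <ᵇ z) ∧_) (<ᵇ-cong iff)
    where
    iff : h ℕ.+ 1 < c ⇔ suc h ℕ.+ 1 < c
    iff rewrite +-comm h 1 = mk⇔ (λ u<c → ≤∧≢⇒< u<c (≢-sym c≢v)) (<-trans (n<1+n u))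

  strict-z : ∀ {c} → c ≢ u → c ≢ v → strict P c z ≡ strict Q c z
  strict-z {c} c≢u c≢v =
    trans (strict-false P c z rowP-z (≢-sym c≢u)) (sym (strict-false Q c z rowQ-z (≢-sym c≢v)))

  nonStrictP-uv : nonStrict P u v ≡ true
  nonStrictP-uv = nonStrict-true P u v rowP-v u<v (subst (_< u) (sym (+-identityʳ col)) col<u)

  nonStrictQ-uv : nonStrict Q u v ≡ true
  nonStrictQ-uv = nonStrict-true Q u v rowQ-v u<v (subst (_< u) (sym (+-identityʳ col)) col<u)

  nonStrictP-vz : nonStrict P v z ≡ true
  nonStrictP-vz = nonStrict-true P v z rowP-z v<z (subst (_< v) (+-comm 1 h) u<v)

  nonStrictP-uz : nonStrict P u z ≡ false
  nonStrictP-uz = nonStrict-false P u z rowP-z (≤-reflexive (+-comm 1 h))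

  nonStrictQ-uz : nonStrict Q u z ≡ false
  nonStrictQ-uz = nonStrict-false Q u z rowQ-z (≤-trans (n≤1+n u) (≤-reflexive (+-comm 1 u)))

  nonStrictQ-vz : nonStrict Q v z ≡ false
  nonStrictQ-vz = nonStrict-false Q v z rowQ-z (≤-reflexive (+-comm 1 u))

  strictP-uz : strict P u z ≡ true
  strictP-uz = strict-true P z rowP-z u<z

  strictQ-vz : strict Q v z ≡ true
  strictQ-vz = strict-true Q z rowQ-z v<z

  strictP-vz : strict P v z ≡ false
  strictP-vz = strict-false P v z rowP-z (<⇒≢ u<v)

  strictQ-uz : strict Q u z ≡ false
  strictQ-uz = strict-false Q u z rowQ-z (>⇒≢ u<v)

  InUV : ℕ → Set
  InUV c = c ≡ u ⊎ c ≡ v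

  inUV? : ∀ c → Dec (InUV c)
  inUV? c = c ≟ u ⊎-dec c ≟ v

  u≤InUV : ∀ {c} → InUV c → u ≤ c
  u≤InUV (inj₁ refl) = ≤-refl
  u≤InUV (inj₂ refl) = n≤1+n u

  InUV≤v : ∀ {c} → InUV c → c ≤ v
  InUV≤v (inj₁ refl) = n≤1+n u
  InUV≤v (inj₂ refl) = ≤-refl

  swapUV : ℕ → ℕ
  swapUV = transpose u

  swapUV-InUV : ∀ {c} → InUV c → InUV (swapUV c)
  swapUV-InUV (inj₁ refl) = inj₂ (transpose-fst u)
  swapUV-InUV (inj₂ refl) = inj₁ (transpose-snd u)

  swapUV-fix : ∀ {c} → ¬ InUV c → swapUV c ≡ c
  swapUV-fix c∉ = transpose-rest u (c∉ ∘ inj₁) (c∉ ∘ inj₂)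

  rowP-uv : ∀ {d} → InUV d → rowInfo P d ≡ (col , false)
  rowP-uv (inj₁ refl) = rowP-u
  rowP-uv (inj₂ refl) = rowP-v

  rowQ-uv : ∀ {d} → InUV d → rowInfo Q d ≡ (col , false)
  rowQ-uv (inj₁ refl) = rowQ-u
  rowQ-uv (inj₂ refl) = rowQ-v

  -- The arcs on which swapping u and v turns Γ_P into Γ_Q.
  Transposable : ℕ → ℕ → Set
  Transposable c d = InUV c → d ≢ u × d ≢ v × d ≢ z

  swapUV-<ᵇ : ∀ {c d} → Transposable c d → (swapUV c <ᵇ swapUV d) ≡ (c <ᵇ d)
  swapUV-<ᵇ tr = <ᵇ-cong (transpose-<-⇔ u (λ (c≡u , d≡v) → proj₁ (proj₂ (tr (inj₁ c≡u))) d≡v)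
                                            (λ (c≡v , d≡u) → proj₁ (tr (inj₂ c≡v)) d≡u))

  -- A row that treats u and v alike.
  TwinRow : ℕ × Bool → Set
  TwinRow (c , d) = c ℕ.+ δ d ≤ h ⊎ v ≤ c

  nonStrictCond-twin : ∀ r {a} → TwinRow r → InUV a → nonStrictCond r (swapUV a) ≡ nonStrictCond r a
  nonStrictCond-twin (c , d) (inj₁ t≤h) a∈ =
    trans (<⇒<ᵇ≡true (<-≤-trans (s≤s t≤h) (u≤InUV (swapUV-InUV a∈))))
          (sym (<⇒<ᵇ≡true (<-≤-trans (s≤s t≤h) (u≤InUV a∈))))
  nonStrictCond-twin (c , d) (inj₂ v≤c) a∈ =
    trans (≥⇒<ᵇ≡false (≤-trans (InUV≤v (swapUV-InUV a∈)) (≤-trans v≤c (m≤m+n c (δ d)))))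
          (sym (≥⇒<ᵇ≡false (≤-trans (InUV≤v a∈) (≤-trans v≤c (m≤m+n c (δ d))))))

  strictCond-uv : ∀ r {a} → TwinRow r → InUV a → strictCond r a ≡ false
  strictCond-uv (c , false) _            _  = refl
  strictCond-uv (c , true)  (inj₁ c+1≤h) a∈ =
    ≢⇒≡ᵇ≡false (<⇒≢ (<-≤-trans (s≤s (subst (_≤ h) (+-comm c 1) c+1≤h)) (u≤InUV a∈)))
  strictCond-uv (c , true)  (inj₂ v≤c)   a∈ = ≢⇒≡ᵇ≡false (>⇒≢ (s≤s (≤-trans (InUV≤v a∈) v≤c)))

  strictCond-twin : ∀ r {a} → TwinRow r → InUV a → strictCond r (swapUV a) ≡ strictCond r a
  strictCond-twin r twin a∈ = trans (strictCond-uv r twin (swapUV-InUV a∈)) (sym (strictCond-uv r twin a∈))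

  module _ (cond : ℕ × Bool → ℕ → Bool)
           (cond-twin : ∀ r {a} → TwinRow r → InUV a → cond r (swapUV a) ≡ cond r a)
           (away : ∀ {c d} → ¬ InUV c → ¬ InUV d →
                   edgeRow cond (rowInfo Q d) c d ≡ edgeRow cond (rowInfo P d) c d) where

    edgeRow-swapUV : ∀ {c d} → d ≤ n → Transposable c d →
                     edgeRow cond (rowInfo Q (swapUV d)) (swapUV c) (swapUV d) ≡ edgeRow cond (rowInfo P d) c d
    edgeRow-swapUV {c} {d} d≤n tr with inUV? c | inUV? d
    ... | no c∉ | no d∉ rewrite swapUV-fix c∉ | swapUV-fix d∉ = away c∉ d∉
    ... | no c∉ | yes d∈ rewrite rowQ-uv (swapUV-InUV d∈) | rowP-uv d∈ =
      cong₂ _∧_ (swapUV-<ᵇ tr) (cong (cond (col , false)) (swapUV-fix c∉))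
    ... | yes c∈ | _ with tr c∈
    ...   | d≢u , d≢v , d≢z rewrite transpose-rest u d≢u d≢v | sym (row-≢z d d≢z) with d ≤? v
    ...     | yes d≤v =
      trans (cong (_∧ cond (rowInfo P d) (swapUV c)) (≥⇒<ᵇ≡false (≤-trans d≤u (u≤InUV (swapUV-InUV c∈)))))
            (sym (cong (_∧ cond (rowInfo P d) c) (≥⇒<ᵇ≡false (≤-trans d≤u (u≤InUV c∈)))))
      where d≤u = ≤-pred (≤∧≢⇒< d≤v d≢v)
    ...     | no d≰v  = cong₂ _∧_ (trans (cong (swapUV c <ᵇ_) (sym (transpose-rest u d≢u d≢v))) (swapUV-<ᵇ tr))
                          (cond-twin (rowInfo P d) (rowP-above d (≰⇒> d≰v) d≤n d≢z) c∈)

  nonStrict-swapUV : ∀ c d → d ≤ n → Transposable c d → nonStrict Q (swapUV c) (swapUV d) ≡ nonStrict P c d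
  nonStrict-swapUV c d = edgeRow-swapUV nonStrictCond nonStrictCond-twin away {c} {d}
    where
    away : ∀ {c d} → ¬ InUV c → ¬ InUV d → nonStrict Q c d ≡ nonStrict P c d
    away {c} {d} c∉ d∉ with d ≟ z
    ... | yes refl = sym (nonStrict-z (c∉ ∘ inj₂))
    ... | no d≢z   = sym (nonStrict-≢z d≢z)

  strict-swapUV : ∀ c d → d ≤ n → Transposable c d → strict Q (swapUV c) (swapUV d) ≡ strict P c d
  strict-swapUV c d = edgeRow-swapUV strictCond strictCond-twin away {c} {d}
    where
    away : ∀ {c d} → ¬ InUV c → ¬ InUV d → strict Q c d ≡ strict P c d
    away {c} {d} c∉ d∉ with d ≟ z
    ... | yes refl = sym (strict-z (c∉ ∘ inj₁) (c∉ ∘ inj₂))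
    ... | no d≢z   = sym (strict-≢z d≢z)

  nonStrict-PQ : ∀ c d → ¬ (c ≡ v × d ≡ z) → nonStrict P c d ≡ nonStrict Q c d
  nonStrict-PQ c d ¬vz with d ≟ z
  ... | no d≢z   = nonStrict-≢z d≢z
  ... | yes refl = nonStrict-z (λ c≡v → ¬vz (c≡v , refl))

  strict-PQ : ∀ c d → ¬ (c ≡ u × d ≡ z) → ¬ (c ≡ v × d ≡ z) → strict P c d ≡ strict Q c d
  strict-PQ c d ¬uz ¬vz with d ≟ z
  ... | no d≢z   = strict-≢z d≢z
  ... | yes refl = strict-z (λ c≡u → ¬uz (c≡u , refl)) (λ c≡v → ¬vz (c≡v , refl))

  usableP-uz : usable P (u , z) ≡ true
  usableP-uz = usable-strict P u z strictP-uz

  usableQ-vz : usable Q (v , z) ≡ true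
  usableQ-vz = usable-strict Q v z strictQ-vz

  ascendingP-uv : isAscending P (u , v) ≡ true
  ascendingP-uv = ascending-true P u<v nonStrictP-uv

  ascendingQ-uv : isAscending Q (u , v) ≡ true
  ascendingQ-uv = ascending-true Q u<v nonStrictQ-uv

  ascendingP-vz : isAscending P (v , z) ≡ true
  ascendingP-vz = ascending-true P v<z nonStrictP-vz

  ascendingP-uz : isAscending P (u , z) ≡ false
  ascendingP-uz = ascending-false P u z nonStrictP-uz

  ascendingQ-vz : isAscending Q (v , z) ≡ false
  ascendingQ-vz = ascending-false Q v z nonStrictQ-vz

  usable-PQ : ∀ c d → ¬ (c ≡ u × d ≡ z) → usable P (c , d) ≡ usable Q (c , d)
  usable-PQ c d ¬uz with c ≟ v | d ≟ z
  ... | yes refl | yes refl = trans (usable-ascending P v z ascendingP-vz) (sym usableQ-vz)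
  ... | no c≢v   | _        = cong₂ _∨_ (strict-PQ c d ¬uz (c≢v ∘ proj₁))
                                         (cong ((c <ᵇ d) ∧_) (nonStrict-PQ c d (c≢v ∘ proj₁)))
  ... | _        | no d≢z   = cong₂ _∨_ (strict-PQ c d ¬uz (d≢z ∘ proj₂))
                                         (cong ((c <ᵇ d) ∧_) (nonStrict-PQ c d (d≢z ∘ proj₂)))

  ascending-PQ : ∀ c d → ¬ (c ≡ v × d ≡ z) → isAscending P (c , d) ≡ isAscending Q (c , d)
  ascending-PQ c d ¬vz = cong ((c <ᵇ d) ∧_) (nonStrict-PQ c d ¬vz)

  record Regular (x y : ℕ) : Set where
    field
      source-vertex : IsVertex n x
      target-vertex : IsVertex n y
      forward       : Transposable x y
      backward      : Transposable y x

  regular-flip : ∀ {x y} → Regular x y → Regular y x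
  regular-flip r = record { source-vertex = target-vertex ; target-vertex = source-vertex
                          ; forward = backward ; backward = forward }
    where open Regular r

  regular-¬uz : ∀ {x y} → Regular x y → ¬ (x ≡ u × y ≡ z)
  regular-¬uz r (refl , refl) = proj₂ (proj₂ (Regular.forward r (inj₁ refl))) refl

  regular-¬vz : ∀ {x y} → Regular x y → ¬ (x ≡ v × y ≡ z)
  regular-¬vz r (refl , refl) = proj₂ (proj₂ (Regular.forward r (inj₂ refl))) refl

  transposable : ∀ {x y} → (InUV x → InUV y ⊎ y ≡ z → ⊥) → Transposable x y
  transposable bad x∈ = bad x∈ ∘ inj₁ ∘ inj₁ , bad x∈ ∘ inj₁ ∘ inj₂ , bad x∈ ∘ inj₂

  usable-swapUV : ∀ {c d} → Regular c d → usable Q (swapUV c , swapUV d) ≡ usable P (c , d)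
  usable-swapUV {c} {d} r =
    cong₂ _∨_ (strict-swapUV c d d≤n forward) (cong₂ _∧_ (swapUV-<ᵇ forward) (nonStrict-swapUV c d d≤n forward))
    where
    open Regular r
    d≤n = proj₂ target-vertex

  ascending-swapUV : ∀ {c d} → Regular c d → isAscending Q (swapUV c , swapUV d) ≡ isAscending P (c , d)
  ascending-swapUV {c} {d} r = cong₂ _∧_ (swapUV-<ᵇ forward) (nonStrict-swapUV c d (proj₂ target-vertex) forward)
    where open Regular r

  strictQ-avoids-uv : ∀ {c d} → d ≤ n → strict Q c d ≡ true → ¬ (c ≡ v × d ≡ z) → ¬ InUV c × ¬ InUV d
  strictQ-avoids-uv {c} {d} d≤n s ¬vz = c∉ , d∉
    where
    d∉ : ¬ InUV d
    d∉ d∈ with () ← trans (sym s) (strict-north Q c d (rowQ-uv d∈))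
    c∉ : ¬ InUV c
    c∉ c∈ with inUV? d | d ≟ z | c∈
    ... | yes d∈ | _        | _         = d∉ d∈
    ... | no _   | yes refl | inj₂ c≡v  = ¬vz (c≡v , refl)
    ... | no _   | yes refl | inj₁ refl with () ← trans (sym s) strictQ-uz
    ... | no d∉′ | no d≢z   | _ with d ≤? v
    ...   | yes d≤v with () ← trans (sym s) (cong (_∧ strictCond (rowInfo Q d) c)
                             (≥⇒<ᵇ≡false (≤-trans (≤-pred (≤∧≢⇒< d≤v (d∉′ ∘ inj₂))) (u≤InUV c∈))))
    ...   | no d≰v  with () ← trans (sym s) (trans (sym (strict-≢z d≢z)) (trans (cong ((c <ᵇ d) ∧_)
                             (strictCond-uv (rowInfo P d) (rowP-above d (≰⇒> d≰v) d≤n d≢z) c∈)) (∧-zeroʳ (c <ᵇ d))))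

  IsNonStrictQ IsStrictQ IsRest IsCommon : Arc → Set
  IsNonStrictQ e = T (nonStrict Q (proj₁ e) (proj₂ e))
  IsStrictQ    e = T (strict Q (proj₁ e) (proj₂ e))
  IsRest       e = IsNonStrictQ e × e ≢ uv
  IsCommon     e = IsStrictQ e × e ≢ vz

  isRest? : Decidable IsRest
  isRest? e = T? _ ×-dec ¬? (e ≟Arc uv)

  isCommon? : Decidable IsCommon
  isCommon? e = T? _ ×-dec ¬? (e ≟Arc vz)

  rest common : List Arc
  rest   = filter isRest? (pairs n)
  common = filter isCommon? (pairs n)

  ∈-rest⁻ : ∀ {e} → e ∈ rest → e ∈ pairs n × IsRest e
  ∈-rest⁻ = ∈-filter⁻ isRest? {xs = pairs n}

  ∈-common⁻ : ∀ {e} → e ∈ common → e ∈ pairs n × IsCommon e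
  ∈-common⁻ = ∈-filter⁻ isCommon? {xs = pairs n}

  u-vertex : IsVertex n u
  u-vertex = s≤s z≤n , ≤-trans (n≤1+n u) v≤n

  v-vertex : IsVertex n v
  v-vertex = s≤s z≤n , v≤n

  z-vertex : IsVertex n z
  z-vertex = ≤-trans (s≤s z≤n) (<⇒≤ v<z) , z≤size

  nonStrictEdgesQ-↭ : nonStrictEdges n Q ↭ uv ∷ rest
  nonStrictEdgesQ-↭ = filter-↭-cons _ isRest? (pairs-unique n) (∈-pairs⁺ u-vertex v-vertex) (λ (_ , ≢uv) → ≢uv refl)
    (mk⇔ (split-at {IsNonStrictQ} uv) λ { (inj₁ refl) → from T-≡ nonStrictQ-uv ; (inj₂ (ns , _)) → ns })

  nonStrictEdgesP-↭ : nonStrictEdges n P ↭ uv ∷ vz ∷ rest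
  nonStrictEdgesP-↭ = ↭-trans
    (filter-↭-cons _ (λ e → T? (nonStrict Q (proj₁ e) (proj₂ e))) (pairs-unique n) (∈-pairs⁺ v-vertex z-vertex)
       (λ ns → case (to T-≡ ns))
       (mk⇔ into back))
    (↭-trans (↭-prep vz nonStrictEdgesQ-↭) (↭-swap vz uv ↭-refl))
    where
    case : nonStrict Q v z ≡ true → ⊥
    case ns with () ← trans (sym ns) nonStrictQ-vz
    into : ∀ {e} → T (nonStrict P (proj₁ e) (proj₂ e)) → e ≡ vz ⊎ IsNonStrictQ e
    into {c , d} ns with split-at {λ e → T (nonStrict P (proj₁ e) (proj₂ e))} vz ns
    ... | inj₁ e≡vz        = inj₁ e≡vz
    ... | inj₂ (ns , ≢vz)  = inj₂ (subst T (nonStrict-PQ c d λ { (refl , refl) → ≢vz refl }) ns)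
    back : ∀ {e} → e ≡ vz ⊎ IsNonStrictQ e → T (nonStrict P (proj₁ e) (proj₂ e))
    back (inj₁ refl) = from T-≡ nonStrictP-vz
    back {c , d} (inj₂ ns) = subst T (sym (nonStrict-PQ c d λ { (refl , refl) → case (to T-≡ ns) })) ns

  strictArcsQ-↭ : strictArcs n Q ↭ vz ∷ common
  strictArcsQ-↭ = filter-↭-cons _ isCommon? (pairs-unique n) (∈-pairs⁺ v-vertex z-vertex) (λ (_ , ≢vz) → ≢vz refl)
    (mk⇔ (split-at {IsStrictQ} vz) λ { (inj₁ refl) → from T-≡ strictQ-vz ; (inj₂ (s , _)) → s })

  strictArcsP-↭ : strictArcs n P ↭ uz ∷ common
  strictArcsP-↭ = filter-↭-cons _ isCommon? (pairs-unique n) (∈-pairs⁺ u-vertex z-vertex)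
    (λ (s , _) → case (to T-≡ s)) (mk⇔ into back)
    where
    case : strict Q u z ≡ true → ⊥
    case s with () ← trans (sym s) strictQ-uz
    into : ∀ {e} → T (strict P (proj₁ e) (proj₂ e)) → e ≡ uz ⊎ IsCommon e
    into {c , d} s with split-at {λ e → T (strict P (proj₁ e) (proj₂ e))} uz s
    ... | inj₁ e≡uz       = inj₁ e≡uz
    ... | inj₂ (s , ≢uz)  with (c , d) ≟Arc vz
    ...   | yes refl with () ← trans (sym (to T-≡ s)) strictP-vz
    ...   | no ≢vz =
      inj₂ (subst T (strict-PQ c d (λ { (refl , refl) → ≢uz refl }) (λ { (refl , refl) → ≢vz refl })) s , ≢vz)
    back : ∀ {e} → e ≡ uz ⊎ IsCommon e → T (strict P (proj₁ e) (proj₂ e))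
    back (inj₁ refl) = from T-≡ strictP-uz
    back {c , d} (inj₂ (s , ≢vz)) =
      subst T (sym (strict-PQ c d (λ { (refl , refl) → case (to T-≡ s) }) (λ { (refl , refl) → ≢vz refl }))) s

  rest-regular : ∀ {c d} → (c , d) ∈ rest → c < d × Regular c d
  rest-regular {c} {d} cd∈ = c<d , record
    { source-vertex = proj₁ (∈-pairs⁻ cd∈pairs) ; target-vertex = proj₂ (∈-pairs⁻ cd∈pairs)
    ; forward = transposable up ; backward = transposable down }
    where
    cd∈pairs = proj₁ (∈-rest⁻ cd∈)
    ns = to T-≡ (proj₁ (proj₂ (∈-rest⁻ cd∈)))
    ≢uv = proj₂ (proj₂ (∈-rest⁻ cd∈))
    c<d : c < d
    c<d = nonStrict⇒< Q c d ns
    up : InUV c → InUV d ⊎ d ≡ z → ⊥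
    up (inj₁ refl) (inj₁ (inj₁ refl)) = <-irrefl refl c<d
    up (inj₁ refl) (inj₁ (inj₂ refl)) = ≢uv refl
    up (inj₂ refl) (inj₁ (inj₁ refl)) = <-asym c<d u<v
    up (inj₂ refl) (inj₁ (inj₂ refl)) = <-irrefl refl c<d
    up (inj₁ refl) (inj₂ refl) with () ← trans (sym ns) nonStrictQ-uz
    up (inj₂ refl) (inj₂ refl) with () ← trans (sym ns) nonStrictQ-vz
    down : InUV d → InUV c ⊎ c ≡ z → ⊥
    down (inj₁ refl) (inj₁ (inj₁ refl)) = <-irrefl refl c<d
    down (inj₁ refl) (inj₁ (inj₂ refl)) = <-asym c<d u<v
    down (inj₂ refl) (inj₁ (inj₁ refl)) = ≢uv refl
    down (inj₂ refl) (inj₁ (inj₂ refl)) = <-irrefl refl c<d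
    down (inj₁ refl) (inj₂ refl) = <-asym c<d u<z
    down (inj₂ refl) (inj₂ refl) = <-asym c<d v<z

  swapArc : Arc → Arc
  swapArc = mapArc swapUV

  swapArc-involutive : ∀ e → swapArc (swapArc e) ≡ e
  swapArc-involutive (c , d) = cong₂ _,_ (transpose-involutive u c) (transpose-involutive u d)

  swapArc-rest : ∀ {e} → e ∈ rest → swapArc e ∈ rest
  swapArc-rest {c , d} cd∈ = ∈-filter⁺ isRest? (∈-pairs⁺ (swap-vertex vc) (swap-vertex vd)) (from T-≡ ns , ≢uv)
    where
    c<d = proj₁ (rest-regular cd∈)
    reg = proj₂ (rest-regular cd∈)
    open Regular reg renaming (source-vertex to vc; target-vertex to vd)
    swap-vertex : ∀ {w} → IsVertex n w → IsVertex n (swapUV w)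
    swap-vertex = transpose-IsVertex u (s≤s z≤n) v≤n
    ns : nonStrict Q (swapUV c) (swapUV d) ≡ true
    ns = trans (nonStrict-swapUV c d (proj₂ vd) forward)
               (trans (nonStrict-PQ c d (regular-¬vz reg)) (to T-≡ (proj₁ (proj₂ (∈-rest⁻ cd∈)))))
    ≢uv : (swapUV c , swapUV d) ≢ uv
    ≢uv eq = <-asym c<d (subst₂ _<_ (sym d≡u) (sym c≡v) u<v)
      where
      c≡v = trans (sym (transpose-involutive u c)) (trans (cong swapUV (cong proj₁ eq)) (transpose-fst u))
      d≡u = trans (sym (transpose-involutive u d)) (trans (cong swapUV (cong proj₂ eq)) (transpose-snd u))

  swapArc-rest-↭ : map swapArc rest ↭ rest
  swapArc-rest-↭ = ↭-unique-sameElements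
    (Unique.map⁺ (λ {e} {e′} eq → trans (sym (swapArc-involutive e)) (trans (cong swapArc eq) (swapArc-involutive e′)))
                 (Unique.filter⁺ isRest? (pairs-unique n)))
    (Unique.filter⁺ isRest? (pairs-unique n))
    (mk⇔ into back)
    where
    into : ∀ {e} → e ∈ map swapArc rest → e ∈ rest
    into e∈ with ∈-map⁻ swapArc e∈
    ... | _ , e′∈ , refl = swapArc-rest e′∈
    back : ∀ {e} → e ∈ rest → e ∈ map swapArc rest
    back {e} e∈ = subst (_∈ map swapArc rest) (swapArc-involutive e) (∈-map⁺ swapArc (swapArc-rest e∈))

  record CommonArc (c d : ℕ) : Set where
    field
      target-vertex : IsVertex n d
      source∉uv     : ¬ InUV c
      target∉uv     : ¬ InUV d
      strictP       : strict P c d ≡ true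
      strictQ       : strict Q c d ≡ true

  common-arc : ∀ {c d} → (c , d) ∈ common → CommonArc c d
  common-arc {c} {d} cd∈ = record
    { target-vertex = vd ; source∉uv = proj₁ avoid ; target∉uv = proj₂ avoid
    ; strictP = trans (strict-PQ c d (λ (c≡u , _) → proj₁ avoid (inj₁ c≡u)) ¬vz) sQ ; strictQ = sQ }
    where
    vd = proj₂ (∈-pairs⁻ (proj₁ (∈-common⁻ cd∈)))
    sQ = to T-≡ (proj₁ (proj₂ (∈-common⁻ cd∈)))
    ¬vz : ¬ (c ≡ v × d ≡ z)
    ¬vz (refl , refl) = proj₂ (proj₂ (∈-common⁻ cd∈)) refl
    avoid = strictQ-avoids-uv (proj₂ vd) sQ ¬vz

  Regular-orientation : List Arc → Set
  Regular-orientation R = ∀ {x y} → (x , y) ∈ R → Regular x y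

  choices-rest-regular : ∀ {R} → R ∈ choices rest → Regular-orientation R
  choices-rest-regular R∈ xy∈ with ∈-choices R∈ xy∈
  ... | inj₁ xy∈rest = proj₂ (rest-regular xy∈rest)
  ... | inj₂ yx∈rest = regular-flip (proj₂ (rest-regular yx∈rest))

  module Orientation (R : List Arc) (R-regular : Regular-orientation R) where

    Base : Rel ℕ 0ℓ
    Base = UsableArc Q (common ++ R)

    WithBase : List Arc → Rel ℕ 0ℓ
    WithBase sp x y = (x , y) ∈ sp ⊎ Base x y

    -- Each orientation below is orient hd sp; its usable arcs are those of Base together with
    -- the usable ones among hd ∷ sp, which are listed in spl.
    orient : Arc → List Arc → List Arc
    orient hd sp = hd ∷ common ++ sp ++ R

    base-¬uz : ∀ {c d} → (c , d) ∈ common ++ R → ¬ (c ≡ u × d ≡ z)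
    base-¬uz {c} {d} cd∈ with ∈-++⁻ common cd∈
    ... | inj₁ cd∈c = λ (c≡u , _) → CommonArc.source∉uv (common-arc cd∈c) (inj₁ c≡u)
    ... | inj₂ cd∈R = regular-¬uz (R-regular cd∈R)

    base-target≤n : ∀ {c d} → (c , d) ∈ common ++ R → d ≤ n
    base-target≤n cd∈ with ∈-++⁻ common cd∈
    ... | inj₁ cd∈c = proj₂ (CommonArc.target-vertex (common-arc cd∈c))
    ... | inj₂ cd∈R = proj₂ (Regular.target-vertex (R-regular cd∈R))

    base-¬uv×uv : ∀ {c d} → (c , d) ∈ common ++ R → ¬ (InUV c × InUV d)
    base-¬uv×uv cd∈ (c∈ , d∈) with ∈-++⁻ common cd∈
    ... | inj₁ cd∈c = CommonArc.source∉uv (common-arc cd∈c) c∈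
    ... | inj₂ cd∈R with d∈
    ...   | inj₁ d≡u = proj₁ (Regular.forward (R-regular cd∈R) c∈) d≡u
    ...   | inj₂ d≡v = proj₁ (proj₂ (Regular.forward (R-regular cd∈R) c∈)) d≡v

    module _ (X : Path) (hd : Arc) (sp spl : List Arc)
             (base-usable : ∀ {c d} → (c , d) ∈ common ++ R → usable X (c , d) ≡ usable Q (c , d))
             (spl-sound : All (λ e → e ∈ hd ∷ sp × T (usable X e)) spl)
             (spl-complete : All (λ e → T (usable X e) → e ∈ spl) (hd ∷ sp))
             (special-bounded : All (λ e → proj₂ e ≤ n) (hd ∷ sp)) where

      private
        usable-orient⇔ : ∀ a b → UsableArc X (orient hd sp) a b ⇔ WithBase spl a b
        usable-orient⇔ a b = mk⇔ into back
          where
          into : UsableArc X (orient hd sp) a b → WithBase spl a b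
          into (here refl , us) = inj₁ (All.head spl-complete us)
          into (there ab∈ , us) with ∈-++⁻ common ab∈
          ... | inj₁ ab∈c = inj₂ (∈-++⁺ˡ ab∈c , subst T (base-usable (∈-++⁺ˡ ab∈c)) us)
          ... | inj₂ ab∈ with ∈-++⁻ sp ab∈
          ...   | inj₁ ab∈sp = inj₁ (All.lookup (All.tail spl-complete) ab∈sp us)
          ...   | inj₂ ab∈R  = inj₂ (∈-++⁺ʳ common ab∈R , subst T (base-usable (∈-++⁺ʳ common ab∈R)) us)
          back : WithBase spl a b → UsableArc X (orient hd sp) a b
          back (inj₁ ab∈spl) with All.lookup spl-sound ab∈spl
          ... | here refl , us   = here refl , us
          ... | there ab∈sp , us = there (∈-++⁺ʳ common (∈-++⁺ˡ ab∈sp)) , us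
          back (inj₂ (ab∈ , us)) with ∈-++⁻ common ab∈
          ... | inj₁ ab∈c = there (∈-++⁺ˡ ab∈c) , subst T (sym (base-usable ab∈)) us
          ... | inj₂ ab∈R = there (∈-++⁺ʳ common (∈-++⁺ʳ sp ab∈R)) , subst T (sym (base-usable ab∈)) us

        orient-upward : Upward n (UsableArc X (orient hd sp))
        orient-upward = upward-usable {X = X} bound
          where
          bound : ∀ {a b} → (a , b) ∈ orient hd sp → b ≤ n
          bound (here refl) = All.head special-bounded
          bound (there ab∈) with ∈-++⁻ common ab∈
          ... | inj₁ ab∈c = base-target≤n (∈-++⁺ˡ ab∈c)
          ... | inj₂ ab∈ with ∈-++⁻ sp ab∈
          ...   | inj₁ ab∈sp = All.lookup (All.tail special-bounded) ab∈sp
          ...   | inj₂ ab∈R  = base-target≤n (∈-++⁺ʳ common ab∈R)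

      orient-HrvOf : HrvOf n (WithBase spl) (hrv n X (orient hd sp))
      orient-HrvOf = record
        { upward = λ a b e → orient-upward a b (from (usable-orient⇔ a b) e)
        ; isHrv  = λ w → IsSuccMax-cong (usable-orient⇔ w) (λ _ _ → refl) (hrv-IsHrv orient-upward w) }

    WithBase-addArc : ∀ {sp K} a b → K b ≤ K a → IsHrv (WithBase sp) K → IsHrv (WithBase ((a , b) ∷ sp)) K
    WithBase-addArc {sp} a b = IsHrv-addArc a b split keep
      where
      split : ∀ x y → WithBase ((a , b) ∷ sp) x y → WithBase sp x y ⊎ (x ≡ a × y ≡ b)
      split x y (inj₁ (here refl)) = inj₂ (refl , refl)
      split x y (inj₁ (there xy∈)) = inj₁ (inj₁ xy∈)
      split x y (inj₂ base)        = inj₁ (inj₂ base)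
      keep : ∀ x y → WithBase sp x y → WithBase ((a , b) ∷ sp) x y
      keep x y (inj₁ xy∈) = inj₁ (there xy∈)
      keep x y (inj₂ base) = inj₂ base

    SameOut-WithBase : ∀ {sp sp′ w} → (∀ {t} → (w , t) ∈ sp ⇔ (w , t) ∈ sp′) → SameOut (WithBase sp) (WithBase sp′) w
    SameOut-WithBase same t = mk⇔ (Sum.map₁ (to same)) (Sum.map₁ (from same))

    WithBase-↭ : ∀ {sp sp′ K} → sp ↭ sp′ → IsHrv (WithBase sp) K → IsHrv (WithBase sp′) K
    WithBase-↭ p H w = IsSuccMax-cong (SameOut-WithBase (mk⇔ (∈-resp-↭ p) (∈-resp-↭ (↭-sym p)))) (λ _ _ → refl) (H w)

    -- Arcs go upward, so arcs out of {u, v} cannot influence the vertices above v.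
    WithBase-agree-above : ∀ {sp sp′ K K′} → All (InUV ∘ proj₁) sp → All (InUV ∘ proj₁) sp′ →
                           Upward n (WithBase sp) → IsHrv (WithBase sp) K → IsHrv (WithBase sp′) K′ →
                           ∀ t → v < t → K t ≡ K′ t
    WithBase-agree-above src src′ up H H′ =
      IsHrv-agree (v <_) up H H′ (λ w t v<w e → <-trans v<w (proj₁ (up w t e)))
        (λ w v<w → inj₂ (SameOut-WithBase (mk⇔ (λ wt∈ → ⊥-elim (above v<w (All.lookup src wt∈)))
                                               (λ wt∈ → ⊥-elim (above v<w (All.lookup src′ wt∈))))))
      where
      above : ∀ {w} → v < w → ¬ InUV w
      above v<w (inj₁ refl) = <-asym v<w u<v
      above v<w (inj₂ refl) = <-irrefl refl v<w

    baseP : ∀ {c d} → (c , d) ∈ common ++ R → usable P (c , d) ≡ usable Q (c , d)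
    baseP cd∈ = usable-PQ _ _ (base-¬uz cd∈)

    usableP-uv : T (usable P uv)
    usableP-uv = from T-≡ (usable-ascending P u v ascendingP-uv)

    usableP-vz : T (usable P vz)
    usableP-vz = from T-≡ (usable-ascending P v z ascendingP-vz)

    usableQ-uv : T (usable Q uv)
    usableQ-uv = from T-≡ (usable-ascending Q u v ascendingQ-uv)

    ¬usable-vu : ∀ X → ¬ T (usable X vu)
    ¬usable-vu X us with () ← trans (sym (to T-≡ us)) (usable-down X (n≤1+n u))

    ¬usable-zv : ∀ X → ¬ T (usable X zv)
    ¬usable-zv X us with () ← trans (sym (to T-≡ us)) (usable-down X (<⇒≤ v<z))

    -- Arrows record the orientations of {u, v} and of {v, z} (↑ ascending, ↓ descending).
    hrvP↑↑ hrvP↑↓ hrvP↓↑ hrvP↓↓ hrvQ↑ : ℕ → ℕ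
    hrvP↑↑ = hrv n P (orient uz (uv ∷ vz ∷ []))
    hrvP↑↓ = hrv n P (orient uz (uv ∷ zv ∷ []))
    hrvP↓↑ = hrv n P (orient uz (vu ∷ vz ∷ []))
    hrvP↓↓ = hrv n P (orient uz (vu ∷ zv ∷ []))
    hrvQ↑  = hrv n Q (orient vz (uv ∷ []))

    H↑↑ : HrvOf n (WithBase (uz ∷ vz ∷ uv ∷ [])) hrvP↑↑
    H↑↑ = orient-HrvOf P uz (uv ∷ vz ∷ []) _ baseP
      ( (here refl , from T-≡ usableP-uz) ∷ (there (there (here refl)) , usableP-vz)
      ∷ (there (here refl) , usableP-uv) ∷ [])
      ((λ _ → here refl) ∷ (λ _ → there (there (here refl))) ∷ (λ _ → there (here refl)) ∷ [])
      (z≤size ∷ v≤n ∷ z≤size ∷ [])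

    H↑↓ : HrvOf n (WithBase (uv ∷ uz ∷ [])) hrvP↑↓
    H↑↓ = orient-HrvOf P uz (uv ∷ zv ∷ []) _ baseP
      ((there (here refl) , usableP-uv) ∷ (here refl , from T-≡ usableP-uz) ∷ [])
      ((λ _ → there (here refl)) ∷ (λ _ → here refl) ∷ (⊥-elim ∘ ¬usable-zv P) ∷ [])
      (z≤size ∷ v≤n ∷ v≤n ∷ [])

    H↓↑ : HrvOf n (WithBase (vz ∷ uz ∷ [])) hrvP↓↑
    H↓↑ = orient-HrvOf P uz (vu ∷ vz ∷ []) _ baseP
      ((there (there (here refl)) , usableP-vz) ∷ (here refl , from T-≡ usableP-uz) ∷ [])
      ((λ _ → there (here refl)) ∷ (⊥-elim ∘ ¬usable-vu P) ∷ (λ _ → here refl) ∷ [])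
      (z≤size ∷ ≤-trans (n≤1+n u) v≤n ∷ z≤size ∷ [])

    H↓↓ : HrvOf n (WithBase (uz ∷ [])) hrvP↓↓
    H↓↓ = orient-HrvOf P uz (vu ∷ zv ∷ []) _ baseP
      ((here refl , from T-≡ usableP-uz) ∷ [])
      ((λ _ → here refl) ∷ (⊥-elim ∘ ¬usable-vu P) ∷ (⊥-elim ∘ ¬usable-zv P) ∷ [])
      (z≤size ∷ ≤-trans (n≤1+n u) v≤n ∷ v≤n ∷ [])

    HQ↑ : HrvOf n (WithBase (vz ∷ uv ∷ [])) hrvQ↑
    HQ↑ = orient-HrvOf Q vz (uv ∷ []) _ (λ _ → refl)
      ((here refl , from T-≡ usableQ-vz) ∷ (there (here refl) , usableQ-uv) ∷ [])
      ((λ _ → here refl) ∷ (λ _ → there (here refl)) ∷ [])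
      (z≤size ∷ v≤n ∷ [])

    hrvP↑↑≗hrvQ↑ : ∀ w → hrvP↑↑ w ≡ hrvQ↑ w
    hrvP↑↑≗hrvQ↑ = HrvOf-unique H↑↑ (WithBase-addArc u z z≤u (isHrv HQ↑))
      where
      z≤u : hrvQ↑ z ≤ hrvQ↑ u
      z≤u = ≤-trans (upper (isHrv HQ↑ v) z (inj₁ (here refl))) (upper (isHrv HQ↑ u) v (inj₁ (there (here refl))))

    WithBase-agree-at : ∀ {sp sp′ K K′} w → IsHrv (WithBase sp) K → IsHrv (WithBase sp′) K′ →
                        (∀ {t} → (w , t) ∈ sp ⇔ (w , t) ∈ sp′) → (∀ t → WithBase sp w t → K t ≡ K′ t) → K w ≡ K′ w
    WithBase-agree-at w H H′ same eqs = IsSuccMax-unique (IsSuccMax-cong (SameOut-WithBase same) eqs (H w)) (H′ w)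

    base-from-u : ∀ {t} → Base u t → v < t
    base-from-u (ut∈ , us) = ≤∧≢⇒< (usable⇒< Q u _ (to T-≡ us)) (λ v≡t → base-¬uv×uv ut∈ (inj₁ refl , inj₂ (sym v≡t)))

    ↑↓-above : ∀ t → v < t → hrvP↑↓ t ≡ hrvP↓↓ t
    ↑↓-above = WithBase-agree-above (inj₁ refl ∷ inj₁ refl ∷ []) (inj₁ refl ∷ []) (upward H↑↓) (isHrv H↑↓) (isHrv H↓↓)

    ↓↑-above : ∀ t → v < t → hrvP↓↑ t ≡ hrvP↓↓ t
    ↓↑-above = WithBase-agree-above (inj₂ refl ∷ inj₁ refl ∷ []) (inj₁ refl ∷ []) (upward H↓↑) (isHrv H↓↑) (isHrv H↓↓)

    ↑↓-at-v : hrvP↑↓ v ≡ hrvP↓↓ v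
    ↑↓-at-v = WithBase-agree-at v (isHrv H↑↓) (isHrv H↓↓) (mk⇔ (λ { (there (here ())) }) (λ { (here ()) }))
                (λ t e → ↑↓-above t (proj₁ (upward H↑↓ v t e)))

    ↓↑-at-u : hrvP↓↑ u ≡ hrvP↓↓ u
    ↓↑-at-u = WithBase-agree-at u (isHrv H↓↑) (isHrv H↓↓)
                (mk⇔ (λ { (there (here refl)) → here refl }) (λ { (here refl) → there (here refl) }))
                λ { t (inj₁ (there (here refl))) → ↓↑-above t v<z ; t (inj₂ base) → ↓↑-above t (base-from-u base) }

    ↓↑-at-v : hrvP↓↑ v ≡ hrvP↓↓ v ⊔ hrvP↓↓ z
    ↓↑-at-v = sym (IsSuccMax-unique
      (IsSuccMax-cong {WithBase (vz ∷ uz ∷ [])} (λ _ → mk⇔ id id) (λ t e → sym (↓↑-above t (proj₁ (upward H↓↑ v t e))))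
        (IsSuccMax-add {WithBase (uz ∷ [])} z split (λ _ → Sum.map₁ there) (inj₁ (here refl)) (isHrv H↓↓ v)))
      (isHrv H↓↑ v))
      where
      split : ∀ t → WithBase (vz ∷ uz ∷ []) v t → WithBase (uz ∷ []) v t ⊎ t ≡ z
      split t (inj₁ (here refl))         = inj₂ refl
      split t (inj₁ (there (here ())))
      split t (inj₂ base)                = inj₁ (inj₂ base)

    z≤u : hrvP↓↓ z ≤ hrvP↓↓ u
    z≤u = upper (isHrv H↓↓ u) z (inj₁ (here refl))

    -- Whichever of K v ≤ K u and K u < K v holds for K = hrvP↓↓, in each of the two mixed
    -- orientations one of the arcs u → v, v → z is redundant.
    hrvP-mixed : ((∀ w → hrvP↑↓ w ≡ hrvP↓↓ w) × (∀ w → hrvP↓↑ w ≡ hrvQ↑ w))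
               ⊎ ((∀ w → hrvP↑↓ w ≡ hrvQ↑ w) × (∀ w → hrvP↓↑ w ≡ hrvP↓↓ w))
    hrvP-mixed with hrvP↓↓ v ≤? hrvP↓↓ u
    ... | yes v≤u = inj₁ (HrvOf-unique H↑↓ (WithBase-addArc u v v≤u (isHrv H↓↓)) ,
                          λ w → trans (sym (↑↑≗↓↑ w)) (hrvP↑↑≗hrvQ↑ w))
      where
      ↓↑-v≤u : hrvP↓↑ v ≤ hrvP↓↑ u
      ↓↑-v≤u = subst₂ _≤_ (sym ↓↑-at-v) (sym ↓↑-at-u) (⊔-lub v≤u z≤u)
      ↑↑≗↓↑ : ∀ w → hrvP↑↑ w ≡ hrvP↓↑ w
      ↑↑≗↓↑ = HrvOf-unique H↑↑ (WithBase-↭ (↭-trans (shift uz (uv ∷ vz ∷ []) []) (↭-prep uz (↭-swap uv vz ↭-refl)))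
                                 (WithBase-addArc u v ↓↑-v≤u (isHrv H↓↑)))
    ... | no v≰u = inj₂ ((λ w → trans (sym (↑↑≗↑↓ w)) (hrvP↑↑≗hrvQ↑ w)) ,
                         HrvOf-unique H↓↑ (WithBase-addArc v z (≤-trans z≤u (<⇒≤ u<v′)) (isHrv H↓↓)))
      where
      u<v′ : hrvP↓↓ u < hrvP↓↓ v
      u<v′ = ≰⇒> v≰u
      ↑↓-z≤v : hrvP↑↓ z ≤ hrvP↑↓ v
      ↑↓-z≤v = subst₂ _≤_ (sym (↑↓-above z v<z)) (sym ↑↓-at-v) (≤-trans z≤u (<⇒≤ u<v′))
      ↑↑≗↑↓ : ∀ w → hrvP↑↑ w ≡ hrvP↑↓ w
      ↑↑≗↑↓ = HrvOf-unique H↑↑ (WithBase-↭ (shift uz (vz ∷ uv ∷ []) []) (WithBase-addArc v z ↑↓-z≤v (isHrv H↑↓)))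

    θQ↓swap : List Arc
    θQ↓swap = vz ∷ common ++ vu ∷ map swapArc R

    hrvQ↓swap : ℕ → ℕ
    hrvQ↓swap = hrv n Q θQ↓swap

    swapUV-out : ∀ {x} → ¬ InUV (swapUV x) → swapUV x ≡ x
    swapUV-out s∉ = swapUV-fix (s∉ ∘ swapUV-InUV)

    swapArc-usable : ∀ {c d} → (c , d) ∈ R → usable Q (swapUV c , swapUV d) ≡ usable Q (c , d)
    swapArc-usable {c} {d} cd∈ =
      trans (usable-swapUV (R-regular cd∈)) (usable-PQ c d (regular-¬uz (R-regular cd∈)))

    swapUV-orientQ : ∀ x y → UsableArc Q θQ↓swap x y ⇔ WithBase (uz ∷ []) (swapUV x) (swapUV y)
    swapUV-orientQ x y = mk⇔ into back
      where
      s = swapUV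
      inv = transpose-involutive u
      s-z : s z ≡ z
      s-z = swapUV-fix λ { (inj₁ z≡u) → <⇒≢ u<z (sym z≡u) ; (inj₂ z≡v) → <⇒≢ v<z (sym z≡v) }
      into : UsableArc Q θQ↓swap x y → WithBase (uz ∷ []) (s x) (s y)
      into (here refl , _) = inj₁ (here (cong₂ _,_ (transpose-snd u) s-z))
      into (there xy∈ , us) with ∈-++⁻ common xy∈
      ... | inj₁ xy∈c = inj₂ (subst₂ Base (sym (swapUV-fix source∉uv)) (sym (swapUV-fix target∉uv)) (∈-++⁺ˡ xy∈c , us))
        where open CommonArc (common-arc xy∈c)
      ... | inj₂ (here refl) = ⊥-elim (¬usable-vu Q us)
      ... | inj₂ (there xy∈′) with ∈-map⁻ swapArc xy∈′
      ...   | (c , d) , cd∈ , refl = inj₂ (subst₂ (λ a b → (a , b) ∈ common ++ R) (sym (inv c)) (sym (inv d)) (∈-++⁺ʳ common cd∈)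
                                         , subst₂ (λ a b → T (usable Q (a , b))) (sym (inv c)) (sym (inv d))
                                             (subst T (swapArc-usable cd∈) us))
      back : WithBase (uz ∷ []) (s x) (s y) → UsableArc Q θQ↓swap x y
      back (inj₁ (here eq)) = subst₂ (UsableArc Q θQ↓swap) x≡v y≡z (here refl , from T-≡ usableQ-vz)
        where
        x≡v = trans (sym (transpose-fst u)) (trans (cong s (sym (cong proj₁ eq))) (inv x))
        y≡z = trans (sym s-z) (trans (cong s (sym (cong proj₂ eq))) (inv y))
      back (inj₂ (sxy∈ , us)) with ∈-++⁻ common sxy∈
      ... | inj₁ sxy∈c = subst₂ (UsableArc Q θQ↓swap) (swapUV-out source∉uv) (swapUV-out target∉uv)
                           (there (∈-++⁺ˡ sxy∈c) , us)
        where open CommonArc (common-arc sxy∈c)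
      ... | inj₂ sxy∈R = subst₂ (UsableArc Q θQ↓swap) (inv x) (inv y)
                           (there (∈-++⁺ʳ common (there (∈-map⁺ swapArc sxy∈R))) ,
                            subst T (sym (swapArc-usable sxy∈R)) us)

    hrvQ↓swap≗ : ∀ w → hrvQ↓swap w ≡ swapUV (hrvP↓↓ (swapUV w))
    hrvQ↓swap≗ = IsHrv-unique upward-Q↓swap (hrv-IsHrv upward-Q↓swap)
                   (IsHrv-transpose u (IsHrv-notValue u (upward H↓↓) (isHrv H↓↓) (>⇒≢ u<K)) (>⇒≢ v<K)
                      swapUV-orientQ (isHrv H↓↓))
      where
      z≤K : z ≤ hrvP↓↓ u
      z≤K = ≤-trans (lower (isHrv H↓↓ z)) z≤u
      u<K : u < hrvP↓↓ u
      u<K = <-≤-trans u<z z≤K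
      v<K : v < hrvP↓↓ u
      v<K = <-≤-trans v<z z≤K
      ¬uv : ¬ WithBase (uz ∷ []) u v
      ¬uv (inj₁ (here eq))  = <⇒≢ v<z (cong proj₂ eq)
      ¬uv (inj₂ (uv∈ , _))  = base-¬uv×uv uv∈ (inj₁ refl , inj₂ refl)
      upward-Q↓swap : Upward n (UsableArc Q θQ↓swap)
      upward-Q↓swap = Upward-transpose u (upward H↓↓) v≤n ¬uv (λ x y → to (swapUV-orientQ x y))

  module _ (xs : List ℤ) (q : ℤ) where

    weight : Path → List Arc → ℤ
    weight X θ = q ℤ.^ asc X θ * eLambda n X θ xs

    weight-↭ : ∀ X → Respects↭ (weight X)
    weight-↭ X p = cong₂ (λ k e → q ℤ.^ k * e) (count-↭ _ p)
      (eLambdaOf-cong n xs (hrv-cong n λ a b →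
        mk⇔ (λ (m , us) → ∈-resp-↭ p m , us) (λ (m , us) → ∈-resp-↭ (↭-sym p) m , us)))

    LLTe-sumChoices : ∀ X → LLTe n X xs q ≡ sumChoices (nonStrictEdges n X) (λ θ → weight X (strictArcs n X ++ θ))
    LLTe-sumChoices X = cong sumℤ (sym (map-∘ (choices (nonStrictEdges n X))))

    gP gQ : List Arc → ℤ
    gP θ = weight P (uz ∷ common ++ θ)
    gQ θ = weight Q (vz ∷ common ++ θ)

    asc-common : ∀ X → (∀ {c d} → CommonArc c d → strict X c d ≡ true) → count (isAscending X) common ≡ 0
    asc-common X strictX = count-none (isAscending X) common λ { (c , d) cd∈ →
      ascending-false X c d (strict⇒¬nonStrict X c d (strictX (common-arc cd∈))) }

    ascP-prefix : ∀ θ → asc P (uz ∷ common ++ θ) ≡ asc P θ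
    ascP-prefix θ = trans (count-no (isAscending P) uz (common ++ θ) ascendingP-uz)
      (trans (count-++ (isAscending P) common θ) (cong (ℕ._+ asc P θ) (asc-common P CommonArc.strictP)))

    ascQ-prefix : ∀ θ → asc Q (vz ∷ common ++ θ) ≡ asc Q θ
    ascQ-prefix θ = trans (count-no (isAscending Q) vz (common ++ θ) ascendingQ-vz)
      (trans (count-++ (isAscending Q) common θ) (cong (ℕ._+ asc Q θ) (asc-common Q CommonArc.strictQ)))

    module PerOrientation (R : List Arc) (R-regular : Regular-orientation R) where
      open Orientation R R-regular

      A : ℕ
      A = asc Q R

      ascP-R : asc P R ≡ A
      ascP-R = count-cong R λ { (c , d) cd∈ → ascending-PQ c d (regular-¬vz (R-regular cd∈)) }

      ascQ-swapR : asc Q (map swapArc R) ≡ A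
      ascQ-swapR = trans (count-map (isAscending Q) swapArc R)
                         (trans (count-cong R λ { (c , d) cd∈ → ascending-swapUV (R-regular cd∈) }) ascP-R)

      ascP↑↑ : asc P (uz ∷ common ++ uv ∷ vz ∷ R) ≡ suc (suc A)
      ascP↑↑ = trans (ascP-prefix (uv ∷ vz ∷ R)) (trans (count-yes (isAscending P) uv (vz ∷ R) ascendingP-uv)
                 (cong suc (trans (count-yes (isAscending P) vz R ascendingP-vz) (cong suc ascP-R))))

      ascP↓↑ : asc P (uz ∷ common ++ vu ∷ vz ∷ R) ≡ suc A
      ascP↓↑ = trans (ascP-prefix (vu ∷ vz ∷ R)) (trans (count-no (isAscending P) vu (vz ∷ R) (ascending-down P (n≤1+n u)))
                 (trans (count-yes (isAscending P) vz R ascendingP-vz) (cong suc ascP-R)))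

      ascP↑↓ : asc P (uz ∷ common ++ uv ∷ zv ∷ R) ≡ suc A
      ascP↑↓ = trans (ascP-prefix (uv ∷ zv ∷ R)) (trans (count-yes (isAscending P) uv (zv ∷ R) ascendingP-uv)
                 (cong suc (trans (count-no (isAscending P) zv R (ascending-down P (<⇒≤ v<z))) ascP-R)))

      ascP↓↓ : asc P (uz ∷ common ++ vu ∷ zv ∷ R) ≡ A
      ascP↓↓ = trans (ascP-prefix (vu ∷ zv ∷ R)) (trans (count-no (isAscending P) vu (zv ∷ R) (ascending-down P (n≤1+n u)))
                 (trans (count-no (isAscending P) zv R (ascending-down P (<⇒≤ v<z))) ascP-R))

      ascQ↑ : asc Q (vz ∷ common ++ uv ∷ R) ≡ suc A
      ascQ↑ = trans (ascQ-prefix (uv ∷ R)) (count-yes (isAscending Q) uv R ascendingQ-uv)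

      ascQ↓swap : asc Q (vz ∷ common ++ vu ∷ map swapArc R) ≡ A
      ascQ↓swap = trans (ascQ-prefix (vu ∷ map swapArc R))
                    (trans (count-no (isAscending Q) vu (map swapArc R) (ascending-down Q (n≤1+n u))) ascQ-swapR)

      weights : (gP (uv ∷ vz ∷ R) + gP (vu ∷ vz ∷ R)) + (gP (uv ∷ zv ∷ R) + gP (vu ∷ zv ∷ R))
              ≡ (q + 1ℤ) * (gQ (uv ∷ R) + gP (vu ∷ zv ∷ R))
      weights rewrite ascP↑↑ | ascP↓↑ | ascP↑↓ | ascP↓↓ | ascQ↑ | eLambdaOf-cong n xs hrvP↑↑≗hrvQ↑ =
        regroup q (q ℤ.^ A) (eLambdaOf n hrvQ↑ xs) (eLambdaOf n hrvP↓↑ xs)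
                            (eLambdaOf n hrvP↑↓ xs) (eLambdaOf n hrvP↓↓ xs) mixed
        where
        mixed : eLambdaOf n hrvP↓↑ xs + eLambdaOf n hrvP↑↓ xs ≡ eLambdaOf n hrvQ↑ xs + eLambdaOf n hrvP↓↓ xs
        mixed with hrvP-mixed
        ... | inj₁ (↑↓≗↓↓ , ↓↑≗Q↑) = cong₂ _+_ (eLambdaOf-cong n xs ↓↑≗Q↑) (eLambdaOf-cong n xs ↑↓≗↓↓)
        ... | inj₂ (↑↓≗Q↑ , ↓↑≗↓↓) = trans (cong₂ _+_ (eLambdaOf-cong n xs ↓↑≗↓↓) (eLambdaOf-cong n xs ↑↓≗Q↑))
                                           (ℤ.+-comm (eLambdaOf n hrvP↓↓ xs) (eLambdaOf n hrvQ↑ xs))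

      weight-swapped : gQ (vu ∷ map swapArc R) ≡ gP (vu ∷ zv ∷ R)
      weight-swapped = cong₂ (λ k e → q ℤ.^ k * e) (trans ascQ↓swap (sym ascP↓↓)) (trans (eLambdaOf-cong n xs hrvQ↓swap≗)
        (eLambdaOf-conjugate n swapUV hrvP↓↓ xs (transpose-involutive u) (transpose-vertices u (s≤s z≤n) v≤n)))

    gP-↭ : Respects↭ gP
    gP-↭ p = weight-↭ P (↭-prep uz (++⁺ˡ common p))

    gQ-↭ : Respects↭ gQ
    gQ-↭ p = weight-↭ Q (↭-prep vz (++⁺ˡ common p))

    LLTe-P : LLTe n P xs q ≡
             sumChoices rest (λ R → (gP (uv ∷ vz ∷ R) + gP (vu ∷ vz ∷ R)) + (gP (uv ∷ zv ∷ R) + gP (vu ∷ zv ∷ R)))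
    LLTe-P = begin
      LLTe n P xs q                                                     ≡⟨ LLTe-sumChoices P ⟩
      sumChoices (nonStrictEdges n P) (λ θ → weight P (strictArcs n P ++ θ))
        ≡⟨ sumChoices-cong (nonStrictEdges n P) (λ θ → weight-↭ P (++⁺ʳ θ strictArcsP-↭)) ⟩
      sumChoices (nonStrictEdges n P) gP                                ≡⟨ sumChoices-↭ nonStrictEdgesP-↭ gP gP-↭ ⟩
      sumChoices (uv ∷ vz ∷ rest) gP                                    ≡⟨ sumChoices-cons u v (vz ∷ rest) gP ⟩
      sumChoices (vz ∷ rest) (λ θ → gP (uv ∷ θ) + gP (vu ∷ θ))          ≡⟨ sumChoices-cons v z rest _ ⟩
      sumChoices rest (λ R → (gP (uv ∷ vz ∷ R) + gP (vu ∷ vz ∷ R)) + (gP (uv ∷ zv ∷ R) + gP (vu ∷ zv ∷ R))) ∎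
      where open ≡-Reasoning

    LLTe-Q : LLTe n Q xs q ≡ sumChoices rest (λ R → gQ (uv ∷ R)) + sumChoices rest (λ R → gQ (vu ∷ R))
    LLTe-Q = begin
      LLTe n Q xs q                                                     ≡⟨ LLTe-sumChoices Q ⟩
      sumChoices (nonStrictEdges n Q) (λ θ → weight Q (strictArcs n Q ++ θ))
        ≡⟨ sumChoices-cong (nonStrictEdges n Q) (λ θ → weight-↭ Q (++⁺ʳ θ strictArcsQ-↭)) ⟩
      sumChoices (nonStrictEdges n Q) gQ                                ≡⟨ sumChoices-↭ nonStrictEdgesQ-↭ gQ gQ-↭ ⟩
      sumChoices (uv ∷ rest) gQ                                         ≡⟨ sumChoices-cons u v rest gQ ⟩
      sumChoices rest (λ R → gQ (uv ∷ R) + gQ (vu ∷ R))                 ≡⟨ sumℤ-map-+ _ _ (choices rest) ⟩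
      sumChoices rest (λ R → gQ (uv ∷ R)) + sumChoices rest (λ R → gQ (vu ∷ R)) ∎
      where open ≡-Reasoning

    swapped-sum : sumChoices rest (λ R → gQ (vu ∷ R)) ≡ sumChoices rest (λ R → gP (vu ∷ zv ∷ R))
    swapped-sum = begin
      sumChoices rest (λ R → gQ (vu ∷ R))                 ≡⟨ sumChoices-↭ (↭-sym swapArc-rest-↭) _ (gQ-↭ ∘ ↭-prep vu) ⟩
      sumChoices (map swapArc rest) (λ R → gQ (vu ∷ R))   ≡⟨ sumChoices-map swapUV rest _ ⟩
      sumChoices rest (λ R → gQ (vu ∷ map swapArc R))
        ≡⟨ sumℤ-map-cong (choices rest) (λ R R∈ → PerOrientation.weight-swapped R (choices-rest-regular R∈)) ⟩
      sumChoices rest (λ R → gP (vu ∷ zv ∷ R))            ∎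
      where open ≡-Reasoning

    LLTe-move : LLTe n P xs q ≡ (q + 1ℤ) * LLTe n Q xs q
    LLTe-move = begin
      LLTe n P xs q
        ≡⟨ LLTe-P ⟩
      sumChoices rest (λ R → (gP (uv ∷ vz ∷ R) + gP (vu ∷ vz ∷ R)) + (gP (uv ∷ zv ∷ R) + gP (vu ∷ zv ∷ R)))
        ≡⟨ sumℤ-map-cong (choices rest) (λ R R∈ → PerOrientation.weights R (choices-rest-regular R∈)) ⟩
      sumChoices rest (λ R → (q + 1ℤ) * (gQ (uv ∷ R) + gP (vu ∷ zv ∷ R)))
        ≡⟨ sumℤ-map-* (q + 1ℤ) _ (choices rest) ⟩
      (q + 1ℤ) * sumChoices rest (λ R → gQ (uv ∷ R) + gP (vu ∷ zv ∷ R))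
        ≡⟨ cong ((q + 1ℤ) *_) (sumℤ-map-+ _ _ (choices rest)) ⟩
      (q + 1ℤ) * (sumChoices rest (λ R → gQ (uv ∷ R)) + sumChoices rest (λ R → gP (vu ∷ zv ∷ R)))
        ≡⟨ cong (λ s → (q + 1ℤ) * (sumChoices rest (λ R → gQ (uv ∷ R)) + s)) swapped-sum ⟨
      (q + 1ℤ) * (sumChoices rest (λ R → gQ (uv ∷ R)) + sumChoices rest (λ R → gQ (vu ∷ R)))
        ≡⟨ cong ((q + 1ℤ) *_) LLTe-Q ⟨
      (q + 1ℤ) * LLTe n Q xs q ∎
      where open ≡-Reasoning

bounceAux-nonempty : ∀ f P u → length (proj₁ (bounceAux f P u)) ≢ 0
bounceAux-nonempty f P u with betweenDiag P (west P u , u)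
bounceAux-nonempty zero    P u | true  = λ ()
bounceAux-nonempty (suc f) P u | true  = λ ()
bounceAux-nonempty f       P u | false = λ ()

single-bounce-end : ∀ f P u → length (proj₁ (bounceAux f P u)) ≡ 1 → proj₂ (proj₂ (bounceAux f P u)) ≡ u
single-bounce-end f P u one with betweenDiag P (west P u , u)
single-bounce-end zero    P u one | true  = refl
single-bounce-end (suc f) P u one | true  with () ← bounceAux-nonempty f P (west P u) (suc-injective one)
single-bounce-end f       P u one | false = refl

LLTe-factorisation : ∀ U V W {n a h y} → endpoint U ≡ (a , h) → endFrom (a , suc (suc h)) V ≡ (h , y) →
                     endFrom (suc (suc h) , suc y) W ≡ (n , n) → suc (suc h) < suc y → (xs : List ℤ) (q : ℤ) →
                     LLTe n (U ++ N ∷ N ∷ V ++ D ∷ E ∷ W) xs q ≡ (q + 1ℤ) * LLTe n (U ++ N ∷ N ∷ V ++ E ∷ D ∷ W) xs q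
LLTe-factorisation U V W endU endV endW v<z xs q = Move.LLTe-move (factorisation-Config U V W endU endV endW v<z) xs q

theorem5p4 : (n : ℕ) (P U V W : List Step) (x z : ℕ) →
    IsSchroder n P →
    (x , z) ∈ positions P →
    suc x < z →
    length (bouncePoints P x z) ≡ 1 →
    P ≡ U ++ N ∷ N ∷ V ++ D ∷ E ∷ W →
    endpoint (U ++ N ∷ []) ≡ bounceEnd P x z →
    endpoint (U ++ N ∷ N ∷ V ++ D ∷ []) ≡ (x , z) →
    (xs : List ℤ) (q : ℤ) →
    LLTe n P xs q ≡ (q + 1ℤ) * LLTe n (U ++ N ∷ N ∷ V ++ E ∷ D ∷ W) xs q
-- Only the endpoints of the factors matter: the single bounce point puts the first north step
-- in row x.
theorem5p4 n P U V W x z (_ , endP) _ x+1<z one-bounce refl endUN endUNNVD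
  with endpoint U in endU
... | a , h with endFrom (a , suc (suc h)) V in endV
...   | c , y with trans (sym (cong proj₂ (endFrom-through U (N ∷ []) endU)))
                         (trans (cong proj₂ endUN) (single-bounce-end (length P) P x one-bounce))
                 | trans (sym (trans (endFrom-through U _ endU) (endFrom-through V (D ∷ []) endV))) endUNNVD
...     | refl | refl = LLTe-factorisation U V W endU endV endW x+1<z
  where
  endW : endFrom (suc (suc h) , suc y) W ≡ (n , n)
  endW = trans (sym (trans (endFrom-through U _ endU) (endFrom-through V (D ∷ E ∷ W) endV))) endP
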